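{- Let $M$ be a $3$-connected matroid with no detachable pairs. Let $X \subseteq E(M)$ with $|X| \geq 2$ and $|E(M)| \geq |X| + 4$. Let $e \in E(M) - X$ be such that $M \backslash e$ is $3$-connected and either $\lambda(X) = 2$ or $\lambda(X \cup \{e\}) = 2$. Let $f \in \mathrm{cl}(X)-(X \cup \{e\})$ be such that $f$ is not contained in a triad of $M$. Then $M$ has a $4$-element cocircuit $\{e,f,g,h\}$ with $g \in X$ and $h \notin X$.
   Context: $\lambda(X)=r(X)+r(E(M)-X)-r(M)$; $\mathrm{cl}$ is closure; a triad is a 3-element cocircuit. A pair $\{e,f\}$ of elements of a 3-connected matroid $M$ is a detachable pair if $M\backslash e\backslash f$ or $M/e/f$ is 3-connected. -}

module Defs where

open import Data.Nat using (ℕ; _+_; _∸_; _≤_; _<_)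
open import Data.Fin using (Fin)
open import Data.Fin.Subset using (Subset; _∈_; _∉_; _⊆_; _∪_; _∩_; _─_; ⁅_⁆; ∣_∣; Nonempty; ⊥)
open import Data.Product using (_×_; Σ; ∃; ∃-syntax; _,_)
open import Data.Sum using (_⊎_)
open import Relation.Binary.PropositionalEquality using (_≡_; _≢_)
open import Relation.Nullary using (¬_)

record Matroid (n : ℕ) : Set where
  field
    E : Subset n
    r : Subset n → ℕ
    r-bound : ∀ X → X ⊆ E → r X ≤ ∣ X ∣
    r-mono  : ∀ X Y → Y ⊆ E → X ⊆ Y → r X ≤ r Y
    r-submod : ∀ X Y → X ⊆ E → Y ⊆ E → r (X ∪ Y) + r (X ∩ Y) ≤ r X + r Y

module _ {n : ℕ} where

  -- A "rank structure": a ground set together with a rank function.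
  -- Minors of a matroid M are represented by such pairs on the same Fin n.

  conn : Subset n → (Subset n → ℕ) → Subset n → ℕ
  conn E r X = (r X + r (E ─ X)) ∸ r E

  Separation : ℕ → Subset n → (Subset n → ℕ) → Subset n → Set
  Separation k E r A = A ⊆ E × k ≤ ∣ A ∣ × k ≤ ∣ E ─ A ∣ × conn E r A < k

  ThreeConnected : Subset n → (Subset n → ℕ) → Set
  ThreeConnected E r = ∀ A → ¬ Separation 1 E r A × ¬ Separation 2 E r A

  delE : Subset n → Subset n → Subset n
  delE E D = E ─ D

  -- contraction M / C : ground set E − C, rank X ↦ r(X ∪ C) − r(C)
  conR : (Subset n → ℕ) → Subset n → Subset n → ℕ
  conR r C X = r (X ∪ C) ∸ r C

  -- cocircuit: minimal nonempty C ⊆ E with r(E − C) < r(E)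
  -- (i.e. a circuit of the dual matroid)
  CoDependent : Subset n → (Subset n → ℕ) → Subset n → Set
  CoDependent E r C = r (E ─ C) < r E

  Cocircuit : Subset n → (Subset n → ℕ) → Subset n → Set
  Cocircuit E r C =
    C ⊆ E × Nonempty C × CoDependent E r C ×
    (∀ D → D ⊆ C → Nonempty D → CoDependent E r D → D ≡ C)

  Triad : Subset n → (Subset n → ℕ) → Subset n → Set
  Triad E r T = Cocircuit E r T × ∣ T ∣ ≡ 3

  InClosure : Subset n → (Subset n → ℕ) → Subset n → Fin n → Set
  InClosure E r X x = x ∈ E × r (X ∪ ⁅ x ⁆) ≡ r X

module _ {n : ℕ} (M : Matroid n) where
  open Matroid M

  ThreeConnectedM : Set
  ThreeConnectedM = ThreeConnected E r

  DetachablePair : Fin n → Fin n → Set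
  DetachablePair e f =
    e ∈ E × f ∈ E × e ≢ f ×
    (ThreeConnected (delE E (⁅ e ⁆ ∪ ⁅ f ⁆)) r
     ⊎ ThreeConnected (delE E (⁅ e ⁆ ∪ ⁅ f ⁆)) (conR r (⁅ e ⁆ ∪ ⁅ f ⁆)))

  NoDetachablePairs : Set
  NoDetachablePairs = ∀ e f → ¬ DetachablePair e f

{-# OPTIONS --safe #-}

-- Write N = M \ e. As M has no detachable pairs, N \ d is not 3-connected for any element d of N,
-- so it has an exact 2-separation. The hypothesis on λ makes X and Y = E(N) − X − f the two sides of
-- a 3-separation of N \ f with f in the closure of both. Uncrossing it with a 2-separation (A, B) of
-- N \ f: f ∈ cl X ∩ cl Y forces all four quadrants to be nonempty, and submodularity forbids A ∩ X
-- and B ∩ Y (or A ∩ Y and B ∩ X) from both having two elements. So either a side of (A, B) is a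
-- pair {g, h} with g ∈ X and h ∉ X, and the other side, of rank less than r(M), contains
-- E − {e, f, g, h}; or X or Y is a pair {a, b}, whence {a, b, f} is a triangle, and uncrossing (A, B)
-- with a 2-separation of N \ a produces such a set {e, f, g, h} again. Either way {e, f, g, h} is
-- codependent, and it is a cocircuit because M has no codependent pair, {e, g, h} is not codependent
-- as N is 3-connected, and f is in no triad.

module Submission where

open import Defs
open import Data.Nat using (ℕ; zero; suc; _+_; _∸_; _≤_; _<_; z≤n; s≤s; _≤?_; _<?_)
open import Data.Nat.Properties hiding (_≟_)
open import Data.Fin using (Fin; zero; suc)
open import Data.Fin.Properties using (_≟_)
open import Data.Fin.Subset
open import Data.Fin.Subset.Properties
open import Data.Vec using ([]; _∷_; here; there)
open import Data.Product using (_×_; ∃; ∃-syntax; _,_; proj₁; proj₂)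
open import Data.Sum using (_⊎_; inj₁; inj₂; [_,_]′; map₁; map₂) renaming (swap to ⊎-swap; map to ⊎-map)
open import Data.Empty using (⊥-elim)
open import Function using (id; _∘_; flip; case_of_)
open import Relation.Binary.PropositionalEquality
open import Relation.Nullary using (¬_; Dec; yes; no; contradiction)
open import Relation.Nullary.Decidable using (_×-dec_; _⊎-dec_)
open import Data.Nat.Tactic.RingSolver using (solve-∀)
open import Algebra.Properties.CommutativeSemigroup +-commutativeSemigroup using (interchange)

private variable
  n : ℕ
  x y : Fin n
  p q : Subset n

-- Finite subsets

x∈p─q⁻ : ∀ (p q : Subset n) → x ∈ p ─ q → x ∈ p × x ∉ q
x∈p─q⁻ {x = zero} (inside ∷ p) (outside ∷ q) here = here , λ ()
x∈p─q⁻ {x = suc _} (_ ∷ p) (_ ∷ q) (there x∈) =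
  let x∈p , x∉q = x∈p─q⁻ p q x∈ in there x∈p , x∉q ∘ drop-there

x∈p-y⁻ : x ∈ p - y → x ∈ p × x ≢ y
x∈p-y⁻ {p = p} {y = y} x∈ = let x∈p , x∉y = x∈p─q⁻ p ⁅ y ⁆ x∈ in x∈p , x∉⁅y⁆⇒x≢y x∉y

x∈⁅y⁆∪p⁻ : x ∈ ⁅ y ⁆ ∪ p → x ≡ y ⊎ x ∈ p
x∈⁅y⁆∪p⁻ {y = y} {p = p} x∈ = map₁ (x∈⁅y⁆⇒x≡y y) (x∈p∪q⁻ ⁅ y ⁆ p x∈)

y∈⁅y⁆∪p : (y : Fin n) → y ∈ ⁅ y ⁆ ∪ p
y∈⁅y⁆∪p {p = p} y = p⊆p∪q p (x∈⁅x⁆ y)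

x∈p∪⁅y⁆⁻ : x ∈ p ∪ ⁅ y ⁆ → x ∈ p ⊎ x ≡ y
x∈p∪⁅y⁆⁻ {p = p} {y = y} x∈ = map₂ (x∈⁅y⁆⇒x≡y y) (x∈p∪q⁻ p ⁅ y ⁆ x∈)

y∈p∪⁅y⁆ : (y : Fin n) → y ∈ p ∪ ⁅ y ⁆
y∈p∪⁅y⁆ {p = p} y = q⊆p∪q p ⁅ y ⁆ (x∈⁅x⁆ y)

x∈⁅u⁆∪⁅v⁆⁻ : ∀ {u v : Fin n} → x ∈ ⁅ u ⁆ ∪ ⁅ v ⁆ → x ≡ u ⊎ x ≡ v
x∈⁅u⁆∪⁅v⁆⁻ {v = v} x∈ = map₂ (x∈⁅y⁆⇒x≡y v) (x∈⁅y⁆∪p⁻ x∈)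

v∈⁅u⁆∪⁅v⁆ : ∀ (u v : Fin n) → v ∈ ⁅ u ⁆ ∪ ⁅ v ⁆
v∈⁅u⁆∪⁅v⁆ u v = q⊆p∪q ⁅ u ⁆ ⁅ v ⁆ (x∈⁅x⁆ v)

x∉⁅y⁆∪p⁻ : x ∉ ⁅ y ⁆ ∪ p → x ≢ y × x ∉ p
x∉⁅y⁆∪p⁻ {p = p} x∉ = (λ { refl → x∉ (y∈⁅y⁆∪p _) }) , x∉ ∘ q⊆p∪q ⁅ _ ⁆ p

x∉⁅y⁆∪p : x ≢ y → x ∉ p → x ∉ ⁅ y ⁆ ∪ p
x∉⁅y⁆∪p x≢y x∉p x∈ = [ x≢y , x∉p ]′ (x∈⁅y⁆∪p⁻ x∈)

p─q⊆p─r : ∀ {p q r : Subset n} → r ⊆ q → p ─ q ⊆ p ─ r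
p─q⊆p─r {p = p} {q = q} r⊆q x∈ = let x∈p , x∉q = x∈p─q⁻ p q x∈ in x∈p∧x∉q⇒x∈p─q x∈p (x∉q ∘ r⊆q)

∣p∪q∣≤∣p∣+∣q∣ : ∀ (p q : Subset n) → ∣ p ∪ q ∣ ≤ ∣ p ∣ + ∣ q ∣
∣p∪q∣≤∣p∣+∣q∣ [] [] = z≤n
∣p∪q∣≤∣p∣+∣q∣ (inside ∷ p) (t ∷ q) =
  s≤s (≤-trans (∣p∪q∣≤∣p∣+∣q∣ p q) (+-monoʳ-≤ ∣ p ∣ (∣p∣≤∣x∷p∣ t q)))
∣p∪q∣≤∣p∣+∣q∣ (outside ∷ p) (inside ∷ q) =
  ≤-trans (s≤s (∣p∪q∣≤∣p∣+∣q∣ p q)) (≤-reflexive (sym (+-suc ∣ p ∣ ∣ q ∣)))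
∣p∪q∣≤∣p∣+∣q∣ (outside ∷ p) (outside ∷ q) = ∣p∪q∣≤∣p∣+∣q∣ p q

∣p∣≤∣p─q∣+∣q∣ : ∀ (p q : Subset n) → ∣ p ∣ ≤ ∣ p ─ q ∣ + ∣ q ∣
∣p∣≤∣p─q∣+∣q∣ p q = ≤-trans (p⊆q⇒∣p∣≤∣q∣ p⊆[p─q]∪q) (∣p∪q∣≤∣p∣+∣q∣ (p ─ q) q)
  where
  p⊆[p─q]∪q : p ⊆ (p ─ q) ∪ q
  p⊆[p─q]∪q {x} x∈p with x ∈? q
  ... | yes x∈q = q⊆p∪q (p ─ q) q x∈q
  ... | no x∉q = p⊆p∪q q (x∈p∧x∉q⇒x∈p─q x∈p x∉q)

∣⁅x⁆∪p∣≤1+∣p∣ : ∀ (x : Fin n) p → ∣ ⁅ x ⁆ ∪ p ∣ ≤ suc ∣ p ∣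
∣⁅x⁆∪p∣≤1+∣p∣ x p = ≤-trans (∣p∪q∣≤∣p∣+∣q∣ ⁅ x ⁆ p) (≤-reflexive (cong (_+ ∣ p ∣) (∣⁅x⁆∣≡1 x)))

x∉p⇒∣⁅x⁆∪p∣≡1+∣p∣ : x ∉ p → ∣ ⁅ x ⁆ ∪ p ∣ ≡ suc ∣ p ∣
x∉p⇒∣⁅x⁆∪p∣≡1+∣p∣ {x = x} {p = p} x∉p = ≤-antisym (∣⁅x⁆∪p∣≤1+∣p∣ x p)
  (p⊂q⇒∣p∣<∣q∣ (q⊆p∪q ⁅ x ⁆ p , x , y∈⁅y⁆∪p x , x∉p))

x∈p⇒1≤∣p∣ : x ∈ p → 1 ≤ ∣ p ∣
x∈p⇒1≤∣p∣ {x = x} {p = p} x∈p = ≤-trans (≤-reflexive (sym (∣⁅x⁆∣≡1 x)))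
  (p⊆q⇒∣p∣≤∣q∣ (λ y∈⁅x⁆ → subst (_∈ p) (sym (x∈⁅y⁆⇒x≡y x y∈⁅x⁆)) x∈p))

Empty⇒∣p∣≡0 : ∀ {n} {p : Subset n} → Empty p → ∣ p ∣ ≡ 0
Empty⇒∣p∣≡0 {n} p-empty = trans (cong ∣_∣ (Empty-unique p-empty)) (∣⊥∣≡0 n)

1≤∣p∣⇒Nonempty : 1 ≤ ∣ p ∣ → Nonempty p
1≤∣p∣⇒Nonempty {p = p} 1≤∣p∣ with nonempty? p
... | yes p-nonempty = p-nonempty
... | no p-empty = contradiction (subst (1 ≤_) (Empty⇒∣p∣≡0 p-empty) 1≤∣p∣) λ ()

AtLeastTwo : Subset n → Set
AtLeastTwo p = ∃[ u ] ∃[ v ] u ≢ v × u ∈ p × v ∈ p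

AtLeastTwo⇒2≤∣p∣ : AtLeastTwo p → 2 ≤ ∣ p ∣
AtLeastTwo⇒2≤∣p∣ {p = p} (u , v , u≢v , u∈p , v∈p) = ≤-trans
  (≤-reflexive (cong suc (sym (∣⁅x⁆∣≡1 u))))
  (p⊂q⇒∣p∣<∣q∣ (⁅u⁆⊆p , v , v∈p , u≢v ∘ sym ∘ x∈⁅y⁆⇒x≡y u))
  where
  ⁅u⁆⊆p : ⁅ u ⁆ ⊆ p
  ⁅u⁆⊆p x∈ = subst (_∈ p) (sym (x∈⁅y⁆⇒x≡y u x∈)) u∈p

AtLeastTwo-mono : p ⊆ q → AtLeastTwo p → AtLeastTwo q
AtLeastTwo-mono p⊆q (u , v , u≢v , u∈p , v∈p) = u , v , u≢v , p⊆q u∈p , p⊆q v∈p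

AtLeastTwo⇒∃≢ : AtLeastTwo p → ∀ y → ∃[ x ] x ∈ p × x ≢ y
AtLeastTwo⇒∃≢ (u , v , u≢v , u∈p , v∈p) y with u ≟ y
... | yes refl = v , v∈p , u≢v ∘ sym
... | no u≢y = u , u∈p , u≢y

p-x⊆⁅h⁆⇒p⊆⁅x⁆∪⁅h⁆ : ∀ {h} → (∀ {z} → z ∈ p - x → z ≡ h) → p ⊆ ⁅ x ⁆ ∪ ⁅ h ⁆
p-x⊆⁅h⁆⇒p⊆⁅x⁆∪⁅h⁆ {x = x} {h = h} only-h {z} z∈p with z ≟ x
... | yes refl = y∈⁅y⁆∪p z
... | no z≢x = subst (_∈ ⁅ x ⁆ ∪ ⁅ h ⁆) (sym (only-h (x∈p∧x≢y⇒x∈p-y z∈p z≢x))) (v∈⁅u⁆∪⁅v⁆ x h)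

x∈⁅u⁆∪⁅v⁆⁺ : ∀ {u v : Fin n} → x ≡ u ⊎ x ≡ v → x ∈ ⁅ u ⁆ ∪ ⁅ v ⁆
x∈⁅u⁆∪⁅v⁆⁺ (inj₁ refl) = y∈⁅y⁆∪p _
x∈⁅u⁆∪⁅v⁆⁺ {u = u} (inj₂ refl) = v∈⁅u⁆∪⁅v⁆ u _

x∈⁅x⁆∪⁅y⁆∪⁅z⁆ : ∀ (x y z : Fin n) → x ∈ ⁅ x ⁆ ∪ ⁅ y ⁆ ∪ ⁅ z ⁆
x∈⁅x⁆∪⁅y⁆∪⁅z⁆ x _ _ = y∈⁅y⁆∪p x

y∈⁅x⁆∪⁅y⁆∪⁅z⁆ : ∀ (x y z : Fin n) → y ∈ ⁅ x ⁆ ∪ ⁅ y ⁆ ∪ ⁅ z ⁆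
y∈⁅x⁆∪⁅y⁆∪⁅z⁆ x y _ = q⊆p∪q ⁅ x ⁆ _ (y∈⁅y⁆∪p y)

z∈⁅x⁆∪⁅y⁆∪⁅z⁆ : ∀ (x y z : Fin n) → z ∈ ⁅ x ⁆ ∪ ⁅ y ⁆ ∪ ⁅ z ⁆
z∈⁅x⁆∪⁅y⁆∪⁅z⁆ x y z = q⊆p∪q ⁅ x ⁆ _ (v∈⁅u⁆∪⁅v⁆ y z)

x∈⁅a⁆∪⁅b⁆∪⁅c⁆⁻ : ∀ {a b c : Fin n} → x ∈ ⁅ a ⁆ ∪ ⁅ b ⁆ ∪ ⁅ c ⁆ → x ≡ a ⊎ x ≡ b ⊎ x ≡ c
x∈⁅a⁆∪⁅b⁆∪⁅c⁆⁻ = map₂ x∈⁅u⁆∪⁅v⁆⁻ ∘ x∈⁅y⁆∪p⁻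

x∈⁅a⁆∪⁅b⁆∪⁅c⁆∪⁅d⁆⁻ : ∀ {a b c d : Fin n} → x ∈ ⁅ a ⁆ ∪ ⁅ b ⁆ ∪ ⁅ c ⁆ ∪ ⁅ d ⁆ →
                     x ≡ a ⊎ x ≡ b ⊎ x ≡ c ⊎ x ≡ d
x∈⁅a⁆∪⁅b⁆∪⁅c⁆∪⁅d⁆⁻ = map₂ x∈⁅a⁆∪⁅b⁆∪⁅c⁆⁻ ∘ x∈⁅y⁆∪p⁻

∣⁅a⁆∪⁅b⁆∪⁅c⁆∣≡3 : ∀ {a b c : Fin n} → a ≢ b → a ≢ c → b ≢ c → ∣ ⁅ a ⁆ ∪ ⁅ b ⁆ ∪ ⁅ c ⁆ ∣ ≡ 3
∣⁅a⁆∪⁅b⁆∪⁅c⁆∣≡3 {a = a} {b} {c} a≢b a≢c b≢c = begin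
  ∣ ⁅ a ⁆ ∪ ⁅ b ⁆ ∪ ⁅ c ⁆ ∣   ≡⟨ x∉p⇒∣⁅x⁆∪p∣≡1+∣p∣ (x∉⁅y⁆∪p a≢b (x≢y⇒x∉⁅y⁆ a≢c)) ⟩
  1 + ∣ ⁅ b ⁆ ∪ ⁅ c ⁆ ∣       ≡⟨ cong (1 +_) (x∉p⇒∣⁅x⁆∪p∣≡1+∣p∣ (x≢y⇒x∉⁅y⁆ b≢c)) ⟩
  2 + ∣ ⁅ c ⁆ ∣               ≡⟨ cong (2 +_) (∣⁅x⁆∣≡1 c) ⟩
  3                           ∎
  where open ≡-Reasoning

data SizeView (p : Subset n) : Set where
  empty     : Empty p → SizeView p
  singleton : ∀ {x} → x ∈ p → (∀ {y} → y ∈ p → y ≡ x) → SizeView p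
  two       : AtLeastTwo p → SizeView p

sizeView : ∀ (p : Subset n) → SizeView p
sizeView p with nonempty? p
... | no p-empty = empty p-empty
... | yes (x , x∈p) with nonempty? (p - x)
...   | yes (y , y∈p-x) = let y∈p , y≢x = x∈p-y⁻ y∈p-x in two (y , x , y≢x , y∈p , x∈p)
...   | no only-x = singleton x∈p is-x
  where
  is-x : ∀ {y} → y ∈ p → y ≡ x
  is-x {y} y∈p with y ≟ x
  ... | yes y≡x = y≡x
  ... | no y≢x = ⊥-elim (only-x (y , x∈p∧x≢y⇒x∈p-y y∈p y≢x))

2≤∣p∣⇒AtLeastTwo : 2 ≤ ∣ p ∣ → AtLeastTwo p
2≤∣p∣⇒AtLeastTwo {p = p} 2≤∣p∣ with sizeView p
... | two p-two = p-two
... | empty p-empty = contradiction (subst (2 ≤_) (Empty⇒∣p∣≡0 p-empty) 2≤∣p∣) λ ()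
... | singleton {x} _ is-x = contradiction (≤-trans 2≤∣p∣ ∣p∣≤1) λ { (s≤s ()) }
  where
  ∣p∣≤1 : ∣ p ∣ ≤ 1
  ∣p∣≤1 = ≤-trans (p⊆q⇒∣p∣≤∣q∣ (λ y∈p → subst (_∈ ⁅ x ⁆) (sym (is-x y∈p)) (x∈⁅x⁆ x)))
                  (≤-reflexive (∣⁅x⁆∣≡1 x))

[w+x]+[y+z]≡[w+z]+[y+x] : ∀ w x y z → (w + x) + (y + z) ≡ (w + z) + (y + x)
[w+x]+[y+z]≡[w+z]+[y+x] = solve-∀

[w+x]+[y+z]≡[w+y]+[z+x] : ∀ w x y z → (w + x) + (y + z) ≡ (w + y) + (z + x)
[w+x]+[y+z]≡[w+y]+[z+x] = solve-∀

pair-or-two-rest : AtLeastTwo p → ∀ x → (∃[ h ] h ≢ x × h ∈ p × p ⊆ ⁅ x ⁆ ∪ ⁅ h ⁆) ⊎ AtLeastTwo (p - x)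
pair-or-two-rest {p = p} p-two x with sizeView (p - x)
... | two rest-two = inj₂ rest-two
... | singleton {h} h∈ only-h = inj₁ (h , proj₂ (x∈p-y⁻ h∈) , proj₁ (x∈p-y⁻ h∈) , p-x⊆⁅h⁆⇒p⊆⁅x⁆∪⁅h⁆ only-h)
... | empty rest-empty =
  let h , h∈p , h≢x = AtLeastTwo⇒∃≢ p-two x in contradiction (h , x∈p∧x≢y⇒x∈p-y h∈p h≢x) rest-empty

singleton⊎AtLeastTwo : Nonempty p → (∃[ x ] x ∈ p × ∀ {y} → y ∈ p → y ≡ x) ⊎ AtLeastTwo p
singleton⊎AtLeastTwo {p = p} (x , x∈p) with sizeView p
... | empty p-empty = contradiction (x , x∈p) p-empty
... | singleton x∈p only-x = inj₁ (_ , x∈p , only-x)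
... | two p-two = inj₂ p-two

¬AtLeastTwo⇒singleton : Nonempty p → ¬ AtLeastTwo p → ∃[ x ] ∀ {y} → y ∈ p → y ≡ x
¬AtLeastTwo⇒singleton p-nonempty ¬two with singleton⊎AtLeastTwo p-nonempty
... | inj₁ (x , _ , only-x) = x , only-x
... | inj₂ p-two = contradiction p-two ¬two

p-x⊆q : (∀ {y} → y ∈ p → y ≢ x → y ∈ q) → p - x ⊆ q
p-x⊆q p-x⊆q′ y∈ = let y∈p , y≢x = x∈p-y⁻ y∈ in p-x⊆q′ y∈p y≢x

⁅x⁆∪p-x⊆p : (⁅ x ⁆ ∪ p) - x ⊆ p
⁅x⁆∪p-x⊆p = p-x⊆q λ y∈ y≢x → [ ⊥-elim ∘ y≢x , id ]′ (x∈⁅y⁆∪p⁻ y∈)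

1+k≤m∸n⇒n+1+k≤m : ∀ m n k → suc k ≤ m ∸ n → n + suc k ≤ m
1+k≤m∸n⇒n+1+k≤m m       zero    k 1+k≤m   = 1+k≤m
1+k≤m∸n⇒n+1+k≤m (suc m) (suc n) k 1+k≤m∸n = s≤s (1+k≤m∸n⇒n+1+k≤m m n k 1+k≤m∸n)

-- Rank of arbitrary subsets

-- The rank axioms only constrain r on subsets of E; ρ is monotone and submodular on all subsets,
-- so no side conditions X ⊆ E are needed.
module TotalRank (M : Matroid n) where
  open Matroid M

  ρ : Subset n → ℕ
  ρ X = r (X ∩ E)

  R : ℕ
  R = ρ E

  private variable
    X Y S T U I W G : Subset n

  ρ≡r : X ⊆ E → ρ X ≡ r X
  ρ≡r {X} X⊆E = cong r (⊆-antisym (p∩q⊆p X E) (λ x∈X → x∈p∩q⁺ (x∈X , X⊆E x∈X)))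

  ∩E-mono : X ⊆ Y → X ∩ E ⊆ Y ∩ E
  ∩E-mono {X} X⊆Y x∈ = let x∈X , x∈E = x∈p∩q⁻ X E x∈ in x∈p∩q⁺ (X⊆Y x∈X , x∈E)

  ρ-mono : X ⊆ Y → ρ X ≤ ρ Y
  ρ-mono {Y = Y} X⊆Y = r-mono _ (Y ∩ E) (p∩q⊆q Y E) (∩E-mono X⊆Y)

  ρ≤R : ρ X ≤ R
  ρ≤R {X} = r-mono _ (E ∩ E) (p∩q⊆q E E) λ x∈ → let x∈E = p∩q⊆q X E x∈ in x∈p∩q⁺ (x∈E , x∈E)

  ρ≤∣_∣ : ∀ X → ρ X ≤ ∣ X ∣
  ρ≤∣ X ∣ = ≤-trans (r-bound (X ∩ E) (p∩q⊆q X E)) (∣p∩q∣≤∣p∣ X E)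

  ρ-submodular : U ⊆ X ∪ Y → I ⊆ X ∩ Y → ρ U + ρ I ≤ ρ X + ρ Y
  ρ-submodular {U} {X} {Y} {I} U⊆X∪Y I⊆X∩Y = ≤-trans
    (+-mono-≤ (r-mono (U ∩ E) _ (∪-⊆E (p∩q⊆q X E) (p∩q⊆q Y E)) U∩E⊆)
              (r-mono (I ∩ E) _ (p∩q⊆q X E ∘ p∩q⊆p (X ∩ E) (Y ∩ E)) I∩E⊆))
    (r-submod (X ∩ E) (Y ∩ E) (p∩q⊆q X E) (p∩q⊆q Y E))
    where
    ∪-⊆E : ∀ {P Q} → P ⊆ E → Q ⊆ E → P ∪ Q ⊆ E
    ∪-⊆E {P} {Q} P⊆E Q⊆E x∈ = [ P⊆E , Q⊆E ]′ (x∈p∪q⁻ P Q x∈)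
    U∩E⊆ : U ∩ E ⊆ (X ∩ E) ∪ (Y ∩ E)
    U∩E⊆ x∈ with x∈p∩q⁻ U E x∈
    ... | x∈U , x∈E = [ (λ x∈X → p⊆p∪q (Y ∩ E) (x∈p∩q⁺ (x∈X , x∈E)))
                      , (λ x∈Y → q⊆p∪q (X ∩ E) (Y ∩ E) (x∈p∩q⁺ (x∈Y , x∈E))) ]′
                      (x∈p∪q⁻ X Y (U⊆X∪Y x∈U))
    I∩E⊆ : I ∩ E ⊆ (X ∩ E) ∩ (Y ∩ E)
    I∩E⊆ x∈ with x∈p∩q⁻ I E x∈
    ... | x∈I , x∈E = let x∈X , x∈Y = x∈p∩q⁻ X Y (I⊆X∩Y x∈I) in
                      x∈p∩q⁺ (x∈p∩q⁺ (x∈X , x∈E) , x∈p∩q⁺ (x∈Y , x∈E))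

  ρ-∪-singleton : ∀ X x → ρ (X ∪ ⁅ x ⁆) ≤ ρ X + 1
  ρ-∪-singleton X x = begin
    ρ (X ∪ ⁅ x ⁆)             ≤⟨ m≤m+n _ _ ⟩
    ρ (X ∪ ⁅ x ⁆) + ρ ⊥       ≤⟨ ρ-submodular id (⊥-elim ∘ ∉⊥) ⟩
    ρ X + ρ ⁅ x ⁆             ≤⟨ +-monoʳ-≤ (ρ X) (≤-trans ρ≤∣ ⁅ x ⁆ ∣ (≤-reflexive (∣⁅x⁆∣≡1 x))) ⟩
    ρ X + 1                   ∎
    where open ≤-Reasoning

  ρ-pair≤2 : ∀ u v → ρ (⁅ u ⁆ ∪ ⁅ v ⁆) ≤ 2
  ρ-pair≤2 u v = ≤-trans ρ≤∣ ⁅ u ⁆ ∪ ⁅ v ⁆ ∣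
    (≤-trans (∣⁅x⁆∪p∣≤1+∣p∣ u ⁅ v ⁆) (≤-reflexive (cong suc (∣⁅x⁆∣≡1 v))))

  ρ-absorb : U ⊆ S ∪ W → I ⊆ S ∩ W → ρ W ≤ ρ I → ρ U ≤ ρ S
  ρ-absorb {U} {S} {W} {I} U⊆S∪W I⊆S∩W ρW≤ρI = +-cancelʳ-≤ (ρ I) (ρ U) (ρ S) (begin
    ρ U + ρ I   ≤⟨ ρ-submodular U⊆S∪W I⊆S∩W ⟩
    ρ S + ρ W   ≤⟨ +-monoʳ-≤ (ρ S) ρW≤ρI ⟩
    ρ S + ρ I   ∎)
    where open ≤-Reasoning

  _∈cl_ : Fin n → Subset n → Set
  x ∈cl S = ρ (S ∪ ⁅ x ⁆) ≤ ρ S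

  ∈cl-mono : ∀ {x} → S ⊆ T → x ∈cl S → x ∈cl T
  ∈cl-mono {S} {T} {x} S⊆T = ρ-absorb T∪x⊆ S⊆
    where
    T∪x⊆ : T ∪ ⁅ x ⁆ ⊆ T ∪ (S ∪ ⁅ x ⁆)
    T∪x⊆ y∈ = [ p⊆p∪q (S ∪ ⁅ x ⁆) , q⊆p∪q T (S ∪ ⁅ x ⁆) ∘ q⊆p∪q S ⁅ x ⁆ ]′ (x∈p∪q⁻ T ⁅ x ⁆ y∈)
    S⊆ : S ⊆ T ∩ (S ∪ ⁅ x ⁆)
    S⊆ y∈S = x∈p∩q⁺ (S⊆T y∈S , p⊆p∪q ⁅ x ⁆ y∈S)

  ρ-sum≤R+k : ∀ k {A} → G ⊆ E → A ⊆ G → conn G r A < suc k → ρ A + ρ (G ─ A) ≤ R + k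
  ρ-sum≤R+k {G} k {A} G⊆E A⊆G λ<1+k = begin
    ρ A + ρ (G ─ A)        ≡⟨ cong₂ _+_ (ρ≡r (G⊆E ∘ A⊆G)) (ρ≡r (G⊆E ∘ p─q⊆p G A)) ⟩
    r A + r (G ─ A)        ≤⟨ m≤n+m∸n _ (r G) ⟩
    r G + conn G r A       ≤⟨ +-mono-≤ (≤-trans (≤-reflexive (sym (ρ≡r G⊆E))) ρ≤R) (≤-pred λ<1+k) ⟩
    R + k                  ∎
    where open ≤-Reasoning

  ρ-submodular′ : ρ W ≤ ρ (X ∪ Y) → ρ (X ∩ Y) + ρ W ≤ ρ X + ρ Y
  ρ-submodular′ {W} {X} {Y} ρW≤ρ[X∪Y] = begin
    ρ (X ∩ Y) + ρ W          ≤⟨ +-monoʳ-≤ (ρ (X ∩ Y)) ρW≤ρ[X∪Y] ⟩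
    ρ (X ∩ Y) + ρ (X ∪ Y)    ≡⟨ +-comm (ρ (X ∩ Y)) (ρ (X ∪ Y)) ⟩
    ρ (X ∪ Y) + ρ (X ∩ Y)    ≤⟨ ρ-submodular id id ⟩
    ρ X + ρ Y                ∎
    where open ≤-Reasoning

  ρ≤-of-∈cl : ∀ {x} → x ∈cl S → U ⊆ S ∪ ⁅ x ⁆ → ρ U ≤ ρ S
  ρ≤-of-∈cl x∈clS U⊆S∪x = ≤-trans (ρ-mono U⊆S∪x) x∈clS

  ¬CoDependent : R ≤ ρ (E ─ S) → ¬ CoDependent E r S
  ¬CoDependent {S} R≤ρ[E─S] = ≤⇒≯ (subst₂ _≤_ (ρ≡r id) (ρ≡r (p─q⊆p E S)) R≤ρ[E─S])

  CoDependent-mono : S ⊆ T → CoDependent E r S → CoDependent E r T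
  CoDependent-mono {S} {T} S⊆T = ≤-trans (s≤s (r-mono (E ─ T) (E ─ S) (p─q⊆p E S) (p─q⊆p─r S⊆T)))

  cocircuit : S ⊆ E → Nonempty S → CoDependent E r S → (∀ {x} → x ∈ S → ¬ CoDependent E r (S - x)) → Cocircuit E r S
  cocircuit {S} S⊆E S-nonempty S-codependent ¬codependent-minus =
    S⊆E , S-nonempty , S-codependent , λ T T⊆S _ T-codependent → ⊆-antisym T⊆S (S⊆T T⊆S T-codependent)
    where
    S⊆T : ∀ {T} → T ⊆ S → CoDependent E r T → S ⊆ T
    S⊆T {T} T⊆S T-codependent {x} x∈S with x ∈? T
    ... | yes x∈T = x∈T
    ... | no x∉T = contradiction (CoDependent-mono (λ y∈T → x∈p∧x≢y⇒x∈p-y (T⊆S y∈T) (λ { refl → x∉T y∈T })) T-codependent)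
                                 (¬codependent-minus x∈S)

  module ThreeConnectedRank (G⊆E : G ⊆ E) (G-3conn : ThreeConnected G r) where

    private
      ρ-sum : ∀ k {S T} → ¬ Separation (suc k) G r (G ∩ S) → suc k ≤ ∣ G ∩ S ∣ → suc k ≤ ∣ G ─ S ∣ →
              G ─ S ⊆ T → ρ G + suc k ≤ ρ S + ρ T
      ρ-sum k {S} {T} no-sep k≤∣A∣ k≤∣G─S∣ G─S⊆T = begin
        ρ G + suc k              ≡⟨ cong (_+ suc k) (ρ≡r G⊆E) ⟩
        r G + suc k              ≤⟨ 1+k≤m∸n⇒n+1+k≤m _ (r G) k
                                      (≮⇒≥ λ λ<k → no-sep (p∩q⊆p G S , k≤∣A∣ , k≤∣G─A∣ , λ<k)) ⟩
        r A + r (G ─ A)          ≡⟨ sym (cong₂ _+_ (ρ≡r (G⊆E ∘ p∩q⊆p G S)) (ρ≡r (G⊆E ∘ p─q⊆p G A))) ⟩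
        ρ A + ρ (G ─ A)          ≤⟨ +-mono-≤ (ρ-mono (p∩q⊆q G S)) (ρ-mono (G─S⊆T ∘ G─A⊆G─S)) ⟩
        ρ S + ρ T                ∎
        where
        open ≤-Reasoning
        A : Subset n
        A = G ∩ S
        G─A⊆G─S : G ─ A ⊆ G ─ S
        G─A⊆G─S x∈ = let x∈G , x∉A = x∈p─q⁻ G A x∈ in x∈p∧x∉q⇒x∈p─q x∈G (x∉A ∘ x∈p∩q⁺ ∘ (x∈G ,_))
        G─S⊆G─A : G ─ S ⊆ G ─ A
        G─S⊆G─A x∈ = let x∈G , x∉S = x∈p─q⁻ G S x∈ in x∈p∧x∉q⇒x∈p─q x∈G (x∉S ∘ p∩q⊆q G S)
        k≤∣G─A∣ : suc k ≤ ∣ G ─ A ∣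
        k≤∣G─A∣ = ≤-trans k≤∣G─S∣ (p⊆q⇒∣p∣≤∣q∣ G─S⊆G─A)

    ρ-sum≥1 : Nonempty (G ∩ S) → Nonempty (G ─ S) → G ─ S ⊆ T → ρ G + 1 ≤ ρ S + ρ T
    ρ-sum≥1 {S} (_ , x∈) (_ , y∈) = ρ-sum 0 (proj₁ (G-3conn (G ∩ S))) (x∈p⇒1≤∣p∣ x∈) (x∈p⇒1≤∣p∣ y∈)

    ρ-sum≥2 : AtLeastTwo (G ∩ S) → AtLeastTwo (G ─ S) → G ─ S ⊆ T → ρ G + 2 ≤ ρ S + ρ T
    ρ-sum≥2 {S} two-in two-out = ρ-sum 1 (proj₂ (G-3conn (G ∩ S))) (AtLeastTwo⇒2≤∣p∣ two-in) (AtLeastTwo⇒2≤∣p∣ two-out)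

module _ {G : Subset n} {r : Subset n → ℕ} where

  separation? : ∀ k A → Dec (Separation k G r A)
  separation? k A = (A ⊆? G) ×-dec (k ≤? ∣ A ∣) ×-dec (k ≤? ∣ G ─ A ∣) ×-dec (conn G r A <? k)

  ¬ThreeConnected⇒separation : ¬ ThreeConnected G r → ∃[ A ] (Separation 1 G r A ⊎ Separation 2 G r A)
  ¬ThreeConnected⇒separation ¬3conn with anySubset? (λ A → separation? 1 A ⊎-dec separation? 2 A)
  ... | yes sep = sep
  ... | no ¬sep = contradiction (λ A → (λ s → ¬sep (A , inj₁ s)) , (λ s → ¬sep (A , inj₂ s))) ¬3conn

-- The setting: M and N = M \ e are 3-connected; E′ is the ground set of N

module DeletionThreeConnected {n : ℕ}
  (M : Matroid n) (M-3conn : ThreeConnectedM M)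
  (e : Fin n) (e∈E : e ∈ Matroid.E M) (N-3conn : ThreeConnected (Matroid.E M - e) (Matroid.r M))
  (5≤∣E∣ : 5 ≤ ∣ Matroid.E M ∣) where

  open Matroid M
  open TotalRank M

  private variable
    S T W Z A B : Subset n
    a b d f u v : Fin n

  E′ : Subset n
  E′ = E - e

  two-outside : ∀ a b c → AtLeastTwo (E ─ (⁅ a ⁆ ∪ ⁅ b ⁆ ∪ ⁅ c ⁆))
  two-outside a b c = 2≤∣p∣⇒AtLeastTwo (+-cancelʳ-≤ 3 2 _ (begin
    5                       ≤⟨ 5≤∣E∣ ⟩
    ∣ E ∣                   ≤⟨ ∣p∣≤∣p─q∣+∣q∣ E abc ⟩
    ∣ E ─ abc ∣ + ∣ abc ∣   ≤⟨ +-monoʳ-≤ _ ∣abc∣≤3 ⟩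
    ∣ E ─ abc ∣ + 3         ∎))
    where
    open ≤-Reasoning
    abc : Subset n
    abc = ⁅ a ⁆ ∪ ⁅ b ⁆ ∪ ⁅ c ⁆
    ∣abc∣≤3 : ∣ abc ∣ ≤ 3
    ∣abc∣≤3 = ≤-trans (∣⁅x⁆∪p∣≤1+∣p∣ a _)
                (s≤s (≤-trans (∣⁅x⁆∪p∣≤1+∣p∣ b _) (s≤s (≤-reflexive (∣⁅x⁆∣≡1 c)))))

  two-outside-E′ : ∀ u v → AtLeastTwo (E′ ─ (⁅ u ⁆ ∪ ⁅ v ⁆))
  two-outside-E′ u v = subst AtLeastTwo (sym (p─q─r≡p─q∪r E ⁅ e ⁆ (⁅ u ⁆ ∪ ⁅ v ⁆))) (two-outside e u v)

  module MR = ThreeConnectedRank {G = E} id M-3conn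
  module NR = ThreeConnectedRank {G = E′} (p─q⊆p E ⁅ e ⁆) N-3conn

  R≤ρE′ : R ≤ ρ E′
  R≤ρE′ = +-cancelʳ-≤ 1 R (ρ E′) (begin
    R + 1              ≤⟨ MR.ρ-sum≥1 (e , x∈p∩q⁺ (e∈E , x∈⁅x⁆ e)) E′-nonempty id ⟩
    ρ ⁅ e ⁆ + ρ E′     ≤⟨ +-monoˡ-≤ (ρ E′) (≤-trans ρ≤∣ ⁅ e ⁆ ∣ (≤-reflexive (∣⁅x⁆∣≡1 e))) ⟩
    1 + ρ E′           ≡⟨ +-comm 1 (ρ E′) ⟩
    ρ E′ + 1           ∎)
    where
    open ≤-Reasoning
    E′-nonempty : Nonempty E′
    E′-nonempty = let u , _ , _ , u∈ , _ = two-outside e e e in u , p─q⊆p─r (p⊆p∪q _) u∈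

  ρ-sum≥R+1 : Nonempty (E′ ∩ S) → Nonempty (E′ ─ S) → E′ ─ S ⊆ T → R + 1 ≤ ρ S + ρ T
  ρ-sum≥R+1 in-S out-S E′─S⊆T = ≤-trans (+-monoˡ-≤ 1 R≤ρE′) (NR.ρ-sum≥1 in-S out-S E′─S⊆T)

  ρ-sum≥R+2 : AtLeastTwo (E′ ∩ S) → AtLeastTwo (E′ ─ S) → E′ ─ S ⊆ T → R + 2 ≤ ρ S + ρ T
  ρ-sum≥R+2 in-S out-S E′─S⊆T = ≤-trans (+-monoˡ-≤ 2 R≤ρE′) (NR.ρ-sum≥2 in-S out-S E′─S⊆T)

  2≤ρ-pair : u ≢ v → u ∈ E′ → v ∈ E′ → 2 ≤ ρ (⁅ u ⁆ ∪ ⁅ v ⁆)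
  2≤ρ-pair {u} {v} u≢v u∈E′ v∈E′ = +-cancelˡ-≤ R 2 _ (begin
    R + 2                   ≤⟨ ρ-sum≥R+2 two-in (two-outside-E′ u v) (p─q⊆p E′ uv) ⟩
    ρ uv + ρ E′             ≤⟨ +-monoʳ-≤ (ρ uv) ρ≤R ⟩
    ρ uv + R                ≡⟨ +-comm (ρ uv) R ⟩
    R + ρ uv                ∎)
    where
    open ≤-Reasoning
    uv : Subset n
    uv = ⁅ u ⁆ ∪ ⁅ v ⁆
    two-in : AtLeastTwo (E′ ∩ uv)
    two-in = u , v , u≢v , x∈p∩q⁺ (u∈E′ , y∈⁅y⁆∪p u) , x∈p∩q⁺ (v∈E′ , v∈⁅u⁆∪⁅v⁆ u v)

  2≤ρ : AtLeastTwo (E′ ∩ Z) → 2 ≤ ρ Z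
  2≤ρ {Z} (u , v , u≢v , u∈ , v∈) = ≤-trans (2≤ρ-pair u≢v (p∩q⊆p E′ Z u∈) (p∩q⊆p E′ Z v∈)) (ρ-mono uv⊆Z)
    where
    uv⊆Z : ⁅ u ⁆ ∪ ⁅ v ⁆ ⊆ Z
    uv⊆Z x∈ = [ (λ { refl → p∩q⊆q E′ Z u∈ }) , (λ { refl → p∩q⊆q E′ Z v∈ }) ]′ (x∈⁅u⁆∪⁅v⁆⁻ x∈)

  1≤ρ : u ∈ E′ → u ∈ Z → 1 ≤ ρ Z
  1≤ρ {u} {Z} u∈E′ u∈Z = ≤-trans (+-cancelˡ-≤ R 1 _ (begin
    R + 1                   ≤⟨ ρ-sum≥R+1 (u , x∈p∩q⁺ (u∈E′ , x∈⁅x⁆ u)) one-out (p─q⊆p E′ ⁅ u ⁆) ⟩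
    ρ ⁅ u ⁆ + ρ E′          ≤⟨ +-monoʳ-≤ (ρ ⁅ u ⁆) ρ≤R ⟩
    ρ ⁅ u ⁆ + R             ≡⟨ +-comm (ρ ⁅ u ⁆) R ⟩
    R + ρ ⁅ u ⁆             ∎)) (ρ-mono u⊆Z)
    where
    open ≤-Reasoning
    one-out : Nonempty (E′ ─ ⁅ u ⁆)
    one-out = let w , _ , _ , w∈ , _ = two-outside-E′ u u in w , p─q⊆p─r (p⊆p∪q ⁅ u ⁆) w∈
    u⊆Z : ⁅ u ⁆ ⊆ Z
    u⊆Z x∈ = subst (_∈ Z) (sym (x∈⁅y⁆⇒x≡y u x∈)) u∈Z

  R+2≰R+1 : ¬ (R + 2 ≤ R + 1)
  R+2≰R+1 R+2≤R+1 = contradiction (+-cancelˡ-≤ R 2 1 R+2≤R+1) λ { (s≤s ()) }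

  record Partition (d : Fin n) (A B : Subset n) : Set where
    field
      A⊆ : ∀ {x} → x ∈ A → x ∈ E′ × x ≢ d
      B⊆ : ∀ {x} → x ∈ B → x ∈ E′ × x ≢ d
      cover : ∀ {x} → x ∈ E′ → x ≢ d → x ∈ A ⊎ x ∈ B
      disjoint : ∀ {x} → x ∈ A → x ∉ B

    A⊆E′ : A ⊆ E′
    A⊆E′ = proj₁ ∘ A⊆

    B⊆E′ : B ⊆ E′
    B⊆E′ = proj₁ ∘ B⊆

    d∉A : d ∉ A
    d∉A d∈A = proj₂ (A⊆ d∈A) refl

    ∉A⇒∈B : ∀ {x} → x ∈ E′ → x ≢ d → x ∉ A → x ∈ B
    ∉A⇒∈B x∈E′ x≢d x∉A = [ flip contradiction x∉A , id ]′ (cover x∈E′ x≢d)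

    ∉B⇒∈A : ∀ {x} → x ∈ E′ → x ≢ d → x ∉ B → x ∈ A
    ∉B⇒∈A x∈E′ x≢d x∉B = [ id , flip contradiction x∉B ]′ (cover x∈E′ x≢d)

    E′∩A-two : AtLeastTwo A → AtLeastTwo (E′ ∩ A)
    E′∩A-two = AtLeastTwo-mono λ x∈A → x∈p∩q⁺ (A⊆E′ x∈A , x∈A)

  swap-partition : Partition d A B → Partition d B A
  swap-partition P = record
    { A⊆ = B⊆ ; B⊆ = A⊆ ; cover = λ x∈E′ x≢d → ⊎-swap (cover x∈E′ x≢d) ; disjoint = flip disjoint }
    where open Partition P

  R+2≤ρA+ρ[B∪d] : Partition d A B → d ∈ E′ → AtLeastTwo A → Nonempty B → R + 2 ≤ ρ A + ρ (B ∪ ⁅ d ⁆)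
  R+2≤ρA+ρ[B∪d] {d} {A} {B} P d∈E′ A-two (w , w∈B) =
    ρ-sum≥R+2 (E′∩A-two A-two)
      (w , d , proj₂ (B⊆ w∈B) , x∈p∧x∉q⇒x∈p─q (B⊆E′ w∈B) (flip disjoint w∈B) , x∈p∧x∉q⇒x∈p─q d∈E′ d∉A)
      E′─A⊆
    where
    open Partition P
    E′─A⊆ : E′ ─ A ⊆ B ∪ ⁅ d ⁆
    E′─A⊆ {x} x∈ with x ≟ d | x∈p─q⁻ E′ A x∈
    ... | yes refl | _ = y∈p∪⁅y⁆ x
    ... | no x≢d | x∈E′ , x∉A = p⊆p∪q ⁅ d ⁆ (∉A⇒∈B x∈E′ x≢d x∉A)

  R+1≤ρA+ρB-of-two : Partition d A B → d ∈ E′ → AtLeastTwo A → Nonempty B → R + 1 ≤ ρ A + ρ B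
  R+1≤ρA+ρB-of-two {d} {A} {B} P d∈E′ A-two B-nonempty = +-cancelʳ-≤ 1 (R + 1) (ρ A + ρ B) (begin
    R + 1 + 1                 ≡⟨ +-assoc R 1 1 ⟩
    R + 2                     ≤⟨ R+2≤ρA+ρ[B∪d] P d∈E′ A-two B-nonempty ⟩
    ρ A + ρ (B ∪ ⁅ d ⁆)       ≤⟨ +-monoʳ-≤ (ρ A) (ρ-∪-singleton B d) ⟩
    ρ A + (ρ B + 1)           ≡⟨ sym (+-assoc (ρ A) (ρ B) 1) ⟩
    ρ A + ρ B + 1             ∎)
    where open ≤-Reasoning

  R+1≤ρA+ρB : Partition d A B → d ∈ E′ → Nonempty A → Nonempty B → R + 1 ≤ ρ A + ρ B
  R+1≤ρA+ρB {d} {A} {B} P d∈E′ (u , u∈A) (w , w∈B) with sizeView A | sizeView B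
  ... | two A-two | _ = R+1≤ρA+ρB-of-two P d∈E′ A-two (w , w∈B)
  ... | _ | two B-two =
    ≤-trans (R+1≤ρA+ρB-of-two (swap-partition P) d∈E′ B-two (u , u∈A)) (≤-reflexive (+-comm (ρ B) (ρ A)))
  ... | empty A-empty | _ = contradiction (u , u∈A) A-empty
  ... | _ | empty B-empty = contradiction (w , w∈B) B-empty
  -- Both sides singletons would leave E = {e, d, u, w}, too small.
  ... | singleton {u} _ only-u | singleton {w} _ only-w =
    let v₁ , v₂ , v₁≢v₂ , v₁∈ , v₂∈ = two-outside e d u in ⊥-elim (v₁≢v₂ (trans (is-w v₁∈) (sym (is-w v₂∈))))
    where
    open Partition P
    is-w : ∀ {v} → v ∈ E ─ (⁅ e ⁆ ∪ ⁅ d ⁆ ∪ ⁅ u ⁆) → v ≡ w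
    is-w {v} v∈ with x∈p─q⁻ E _ v∈
    ... | v∈E , v∉edu with x∉⁅y⁆∪p⁻ v∉edu
    ...   | v≢e , v∉du with x∉⁅y⁆∪p⁻ v∉du
    ...     | v≢d , v∉u = only-w (∉A⇒∈B (x∈p∧x≢y⇒x∈p-y v∈E v≢e) v≢d (x∉⁅y⁆⇒x≢y v∉u ∘ only-u))

  -- An exact 2-separation of N \ d, whose rank is R.
  record TwoSeparation (d : Fin n) (A B : Subset n) : Set where
    field
      partition : Partition d A B
      A-two : AtLeastTwo A
      B-two : AtLeastTwo B
      rank-sum : ρ A + ρ B ≤ R + 1

    open Partition partition public

    A-nonempty : Nonempty A
    A-nonempty = let u , _ , _ , u∈A , _ = A-two in u , u∈A

    ρB<R : ρ B < R
    ρB<R = ≤-pred (begin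
      2 + ρ B     ≤⟨ +-monoˡ-≤ (ρ B) (2≤ρ (E′∩A-two A-two)) ⟩
      ρ A + ρ B   ≤⟨ rank-sum ⟩
      R + 1       ≡⟨ +-comm R 1 ⟩
      1 + R       ∎)
      where open ≤-Reasoning

  swap-separation : TwoSeparation d A B → TwoSeparation d B A
  swap-separation {A = A} {B = B} sep = record
    { partition = swap-partition partition ; A-two = B-two ; B-two = A-two
    ; rank-sum = ≤-trans (≤-reflexive (+-comm (ρ B) (ρ A))) rank-sum }
    where open TwoSeparation sep

  complement-partition : A ⊆ E′ - d → Partition d A (E′ - d ─ A)
  complement-partition {A} {d} A⊆ = record
    { A⊆ = x∈p-y⁻ ∘ A⊆
    ; B⊆ = x∈p-y⁻ ∘ proj₁ ∘ x∈p─q⁻ (E′ - d) A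
    ; cover = cover
    ; disjoint = λ x∈A x∈ → proj₂ (x∈p─q⁻ (E′ - d) A x∈) x∈A }
    where
    cover : ∀ {x} → x ∈ E′ → x ≢ d → x ∈ A ⊎ x ∈ E′ - d ─ A
    cover {x} x∈E′ x≢d with x ∈? A
    ... | yes x∈A = inj₁ x∈A
    ... | no x∉A = inj₂ (x∈p∧x∉q⇒x∈p─q (x∈p∧x≢y⇒x∈p-y x∈E′ x≢d) x∉A)

  two-separation : d ∈ E′ → ¬ ThreeConnected (E ─ (⁅ e ⁆ ∪ ⁅ d ⁆)) r → ∃[ A ] ∃[ B ] TwoSeparation d A B
  two-separation {d} d∈E′ ¬3conn
    with ¬ThreeConnected⇒separation {G = E′ - d} {r = r}
           (subst (λ G → ¬ ThreeConnected G r) (sym (p─q─r≡p─q∪r E ⁅ e ⁆ ⁅ d ⁆)) ¬3conn)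
  ... | A , inj₂ (A⊆ , 2≤∣A∣ , 2≤∣B∣ , λ<2) = A , E′ - d ─ A , record
    { partition = complement-partition A⊆
    ; A-two = 2≤∣p∣⇒AtLeastTwo 2≤∣A∣
    ; B-two = 2≤∣p∣⇒AtLeastTwo 2≤∣B∣
    ; rank-sum = ρ-sum≤R+k 1 (p─q⊆p E ⁅ e ⁆ ∘ p─q⊆p E′ ⁅ d ⁆) A⊆ λ<2 }
  ... | A , inj₁ (A⊆ , 1≤∣A∣ , 1≤∣B∣ , λ<1) = contradiction
    (+-cancelˡ-≤ R 1 0 (≤-trans
      (R+1≤ρA+ρB (complement-partition A⊆) d∈E′ (1≤∣p∣⇒Nonempty 1≤∣A∣) (1≤∣p∣⇒Nonempty 1≤∣B∣))
      (ρ-sum≤R+k 0 (p─q⊆p E ⁅ e ⁆ ∘ p─q⊆p E′ ⁅ d ⁆) A⊆ λ<1)))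
    λ ()

  d∉clA : TwoSeparation d A B → d ∈ E′ → ¬ d ∈cl A
  d∉clA {d} {A} {B} sep d∈E′ d∈clA = R+2≰R+1 (begin
    R + 2                  ≤⟨ R+2≤ρA+ρ[B∪d] (swap-partition partition) d∈E′ B-two A-nonempty ⟩
    ρ B + ρ (A ∪ ⁅ d ⁆)    ≤⟨ +-monoʳ-≤ (ρ B) d∈clA ⟩
    ρ B + ρ A              ≡⟨ +-comm (ρ B) (ρ A) ⟩
    ρ A + ρ B              ≤⟨ rank-sum ⟩
    R + 1                  ∎)
    where
    open ≤-Reasoning
    open TwoSeparation sep

  ∈cl-line : ρ W ≤ 2 → u ≢ v → u ∈ E′ → v ∈ E′ → u ∈ W → v ∈ W → ∀ {x} → x ∈ W →
             u ∈ Z → v ∈ Z → x ∈cl Z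
  ∈cl-line {W} {u} {v} {Z} ρW≤2 u≢v u∈E′ v∈E′ u∈W v∈W {x} x∈W u∈Z v∈Z = ∈cl-mono uv⊆Z (begin
    ρ ((⁅ u ⁆ ∪ ⁅ v ⁆) ∪ ⁅ x ⁆)   ≤⟨ ρ-mono uvx⊆W ⟩
    ρ W                           ≤⟨ ρW≤2 ⟩
    2                             ≤⟨ 2≤ρ-pair u≢v u∈E′ v∈E′ ⟩
    ρ (⁅ u ⁆ ∪ ⁅ v ⁆)             ∎)
    where
    open ≤-Reasoning
    uv⊆Z : ⁅ u ⁆ ∪ ⁅ v ⁆ ⊆ Z
    uv⊆Z y∈ = [ (λ { refl → u∈Z }) , (λ { refl → v∈Z }) ]′ (x∈⁅u⁆∪⁅v⁆⁻ y∈)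
    uvx⊆W : (⁅ u ⁆ ∪ ⁅ v ⁆) ∪ ⁅ x ⁆ ⊆ W
    uvx⊆W y∈ with x∈p∪⁅y⁆⁻ y∈
    ... | inj₂ refl = x∈W
    ... | inj₁ y∈uv = [ (λ { refl → u∈W }) , (λ { refl → v∈W }) ]′ (x∈⁅u⁆∪⁅v⁆⁻ y∈uv)

  module Line {a b f : Fin n} (a∈E′ : a ∈ E′) (b∈E′ : b ∈ E′) (f∈E′ : f ∈ E′) (a≢b : a ≢ b) (b≢f : b ≢ f)
              (line : ρ (⁅ a ⁆ ∪ ⁅ b ⁆ ∪ ⁅ f ⁆) ≤ 2) where

    f∈cl : a ∈ Z → b ∈ Z → f ∈cl Z
    f∈cl = ∈cl-line line a≢b a∈E′ b∈E′
             (x∈⁅x⁆∪⁅y⁆∪⁅z⁆ a b f) (y∈⁅x⁆∪⁅y⁆∪⁅z⁆ a b f) (z∈⁅x⁆∪⁅y⁆∪⁅z⁆ a b f)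

    a∈cl : b ∈ Z → f ∈ Z → a ∈cl Z
    a∈cl = ∈cl-line line b≢f b∈E′ f∈E′
             (y∈⁅x⁆∪⁅y⁆∪⁅z⁆ a b f) (z∈⁅x⁆∪⁅y⁆∪⁅z⁆ a b f) (x∈⁅x⁆∪⁅y⁆∪⁅z⁆ a b f)

  -- 3-connectivity of N applied to (A - x, B ∪ {d, x}), where x adds no rank to B ∪ {d}.
  ρA≤ρ[A-x] : TwoSeparation d A B → d ∈ E′ → ∀ {x} → x ∈ A → x ∈cl (B ∪ ⁅ d ⁆) →
              AtLeastTwo (A - x) → ρ A ≤ ρ (A - x)
  ρA≤ρ[A-x] {d} {A} {B} sep d∈E′ {x} x∈A x∈cl[B∪d] A-x-two =
    +-cancelʳ-≤ (ρ B + 1) (ρ A) (ρ (A - x)) (begin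
      ρ A + (ρ B + 1)                       ≡⟨ sym (+-assoc (ρ A) (ρ B) 1) ⟩
      ρ A + ρ B + 1                         ≤⟨ +-monoˡ-≤ 1 rank-sum ⟩
      R + 1 + 1                             ≡⟨ +-assoc R 1 1 ⟩
      R + 2                                 ≤⟨ ρ-sum≥R+2 (AtLeastTwo-mono A-x⊆E′∩ A-x-two) x,d-outside E′─[A-x]⊆ ⟩
      ρ (A - x) + ρ ((B ∪ ⁅ d ⁆) ∪ ⁅ x ⁆)   ≤⟨ +-monoʳ-≤ (ρ (A - x)) (≤-trans x∈cl[B∪d] (ρ-∪-singleton B d)) ⟩
      ρ (A - x) + (ρ B + 1)                 ∎)
    where
    open ≤-Reasoning
    open TwoSeparation sep
    A-x⊆E′∩ : A - x ⊆ E′ ∩ (A - x)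
    A-x⊆E′∩ z∈ = x∈p∩q⁺ (A⊆E′ (proj₁ (x∈p-y⁻ z∈)) , z∈)
    x,d-outside : AtLeastTwo (E′ ─ (A - x))
    x,d-outside = x , d , proj₂ (A⊆ x∈A)
      , x∈p∧x∉q⇒x∈p─q (A⊆E′ x∈A) (λ x∈ → proj₂ (x∈p-y⁻ x∈) refl)
      , x∈p∧x∉q⇒x∈p─q d∈E′ (d∉A ∘ proj₁ ∘ x∈p-y⁻)
    E′─[A-x]⊆ : E′ ─ (A - x) ⊆ (B ∪ ⁅ d ⁆) ∪ ⁅ x ⁆
    E′─[A-x]⊆ {z} z∈ with z ≟ x | z ≟ d | x∈p─q⁻ E′ (A - x) z∈
    ... | yes refl | _ | _ = y∈p∪⁅y⁆ z
    ... | no _ | yes refl | _ = p⊆p∪q ⁅ x ⁆ (y∈p∪⁅y⁆ z)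
    ... | no z≢x | no z≢d | z∈E′ , z∉A-x =
      p⊆p∪q ⁅ x ⁆ (p⊆p∪q ⁅ d ⁆ (∉A⇒∈B z∈E′ z≢d (z∉A-x ∘ flip x∈p∧x≢y⇒x∈p-y z≢x)))

  -- {e, f, g, h} is codependent in M, witnessed by a set of rank less than r(M) containing the rest of E.
  QuadCoDependent : Fin n → Fin n → Fin n → Set
  QuadCoDependent f g h = ∃[ H ] ρ H < R × (∀ {z} → z ∈ E′ → z ≢ f → z ≢ g → z ≢ h → z ∈ H)

  record QuadAcross (f : Fin n) (X : Subset n) : Set where
    constructor quad-across
    field
      {g h} : Fin n
      g∈X : g ∈ X
      h∈E′ : h ∈ E′
      h≢f : h ≢ f
      h∉X : h ∉ X
      codependent : QuadCoDependent f g h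

  QuadCoDependent-swap₁₂ : ∀ {f g h} → QuadCoDependent f g h → QuadCoDependent g f h
  QuadCoDependent-swap₁₂ (H , ρH<R , covers) = H , ρH<R , λ z∈E′ z≢g z≢f → covers z∈E′ z≢f z≢g

  QuadCoDependent-swap₂₃ : ∀ {f g h} → QuadCoDependent f g h → QuadCoDependent f h g
  QuadCoDependent-swap₂₃ (H , ρH<R , covers) = H , ρH<R , λ z∈E′ z≢f z≢h z≢g → covers z∈E′ z≢f z≢g z≢h

  pair-side-codependent : TwoSeparation d A B → A ⊆ ⁅ u ⁆ ∪ ⁅ v ⁆ → QuadCoDependent d u v
  pair-side-codependent {B = B} sep A⊆uv = B , ρB<R , λ z∈E′ z≢d z≢u z≢v →
    ∉A⇒∈B z∈E′ z≢d (λ z∈A → [ z≢u , z≢v ]′ (x∈⁅u⁆∪⁅v⁆⁻ (A⊆uv z∈A)))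
    where open TwoSeparation sep

  -- Submodularity bounds conn′ (A ∩ D) + conn′ (B ∩ C) by 2R + 2 and conn′ (A ∩ C) + conn′ (B ∩ D)
  -- by 2R + 3. This leaves A ∩ C = {p}, A ∩ D = {q} and B ∩ C = {s}; then ρ A, ρ C ≤ 2 force
  -- B ∪ D ⊇ E′ − {f, a, p} to have rank less than R.
  module Uncrossing
    {a b f : Fin n} {A B C D : Subset n}
    (a∈E′ : a ∈ E′) (b∈E′ : b ∈ E′) (f∈E′ : f ∈ E′) (a≢f : a ≢ f) (b≢f : b ≢ f)
    (line : ρ (⁅ a ⁆ ∪ ⁅ b ⁆ ∪ ⁅ f ⁆) ≤ 2)
    (sep-f : TwoSeparation f A B) (sep-a : TwoSeparation a C D)
    (a∈A : a ∈ A) (b∈B : b ∈ B) (f∈C : f ∈ C) (b∈D : b ∈ D)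
    (A-a-two : AtLeastTwo (A - a)) (ρA≤ρ[A-a] : ρ A ≤ ρ (A - a))
    (B-b-two : AtLeastTwo (B - b))
    (C-f-two : AtLeastTwo (C - f)) (ρC≤ρ[C-f] : ρ C ≤ ρ (C - f))
    where

    module Sf = TwoSeparation sep-f
    module Sa = TwoSeparation sep-a

    a≢b : a ≢ b
    a≢b refl = Sf.disjoint a∈A b∈B

    open Line a∈E′ b∈E′ f∈E′ a≢b b≢f line

    f∈cl[A∪D] : f ∈cl (A ∪ D)
    f∈cl[A∪D] = f∈cl (p⊆p∪q D a∈A) (q⊆p∪q A D b∈D)

    a∈cl[B∪C] : a ∈cl (B ∪ C)
    a∈cl[B∪C] = a∈cl (p⊆p∪q C b∈B) (q⊆p∪q B C f∈C)

    a∈cl[B∪D∪f] : a ∈cl ((B ∪ D) ∪ ⁅ f ⁆)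
    a∈cl[B∪D∪f] = a∈cl (p⊆p∪q ⁅ f ⁆ (p⊆p∪q D b∈B)) (y∈p∪⁅y⁆ f)

    x∈B⇒x≢a : ∀ {x} → x ∈ B → x ≢ a
    x∈B⇒x≢a x∈B refl = Sf.disjoint a∈A x∈B

    x∈D⇒x≢f : ∀ {x} → x ∈ D → x ≢ f
    x∈D⇒x≢f x∈D refl = Sa.disjoint f∈C x∈D

    split-A : ∀ {x} → x ∈ A → x ≢ a → x ∈ A ∩ C ⊎ x ∈ A ∩ D
    split-A x∈A x≢a = ⊎-map (x∈p∩q⁺ ∘ (x∈A ,_)) (x∈p∩q⁺ ∘ (x∈A ,_)) (Sa.cover (Sf.A⊆E′ x∈A) x≢a)

    split-B : ∀ {x} → x ∈ B → x ∈ B ∩ C ⊎ x ∈ B ∩ D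
    split-B x∈B = ⊎-map (x∈p∩q⁺ ∘ (x∈B ,_)) (x∈p∩q⁺ ∘ (x∈B ,_)) (Sa.cover (Sf.B⊆E′ x∈B) (x∈B⇒x≢a x∈B))

    split-C : ∀ {x} → x ∈ C → x ≢ f → x ∈ A ∩ C ⊎ x ∈ B ∩ C
    split-C x∈C x≢f = ⊎-map (x∈p∩q⁺ ∘ (_, x∈C)) (x∈p∩q⁺ ∘ (_, x∈C)) (Sf.cover (Sa.A⊆E′ x∈C) x≢f)

    split-D : ∀ {x} → x ∈ D → x ∈ A ∩ D ⊎ x ∈ B ∩ D
    split-D x∈D = ⊎-map (x∈p∩q⁺ ∘ (_, x∈D)) (x∈p∩q⁺ ∘ (_, x∈D)) (Sf.cover (Sa.B⊆E′ x∈D) (x∈D⇒x≢f x∈D))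

    -- conn′ Z = λ_N(Z) + r(M), which avoids truncated subtraction.
    conn′ : Subset n → ℕ
    conn′ Z = ρ Z + ρ (E′ ─ Z)

    Quadrant : Subset n → Set
    Quadrant Z = ∀ {x} → x ∈ Z → x ∈ E′ × x ≢ a × x ≢ f

    quadrant : ∀ {U V} → (∀ {x} → x ∈ U → x ∈ E′ × x ≢ f) → (∀ {x} → x ∈ V → x ∈ E′ × x ≢ a) →
               Quadrant (U ∩ V)
    quadrant {U} {V} U⊆ V⊆ x∈ =
      let x∈U , x∈V = x∈p∩q⁻ U V x∈ in proj₁ (U⊆ x∈U) , proj₂ (V⊆ x∈V) , proj₂ (U⊆ x∈U)

    R+1≤conn′ : Quadrant Z → Nonempty Z → R + 1 ≤ conn′ Z
    R+1≤conn′ quad (z , z∈Z) =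
      ρ-sum≥R+1 (z , x∈p∩q⁺ (proj₁ (quad z∈Z) , z∈Z))
                (a , x∈p∧x∉q⇒x∈p─q a∈E′ (λ a∈Z → proj₁ (proj₂ (quad a∈Z)) refl)) id

    R+2≤conn′ : Quadrant Z → AtLeastTwo Z → R + 2 ≤ conn′ Z
    R+2≤conn′ quad Z-two = ρ-sum≥R+2 (AtLeastTwo-mono (λ z∈Z → x∈p∩q⁺ (proj₁ (quad z∈Z) , z∈Z)) Z-two)
      (a , f , a≢f , x∈p∧x∉q⇒x∈p─q a∈E′ (λ a∈Z → proj₁ (proj₂ (quad a∈Z)) refl)
                   , x∈p∧x∉q⇒x∈p─q f∈E′ (λ f∈Z → proj₂ (proj₂ (quad f∈Z)) refl)) id

    E′─[B∩C]⊆ : E′ ─ (B ∩ C) ⊆ (A ∪ D) ∪ ⁅ f ⁆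
    E′─[B∩C]⊆ {z} z∈ with x∈p─q⁻ E′ (B ∩ C) z∈ | z ≟ f
    ... | _ | yes refl = y∈p∪⁅y⁆ z
    ... | z∈E′ , z∉B∩C | no z≢f with Sf.cover z∈E′ z≢f
    ...   | inj₁ z∈A = p⊆p∪q ⁅ f ⁆ (p⊆p∪q D z∈A)
    ...   | inj₂ z∈B = p⊆p∪q ⁅ f ⁆ (q⊆p∪q A D ([ flip contradiction z∉B∩C , proj₂ ∘ x∈p∩q⁻ B D ]′ (split-B z∈B)))

    E′─[A∩D]⊆ : E′ ─ (A ∩ D) ⊆ (B ∪ C) ∪ ⁅ a ⁆
    E′─[A∩D]⊆ {z} z∈ with x∈p─q⁻ E′ (A ∩ D) z∈ | z ≟ a
    ... | _ | yes refl = y∈p∪⁅y⁆ z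
    ... | z∈E′ , z∉A∩D | no z≢a with Sa.cover z∈E′ z≢a
    ...   | inj₁ z∈C = p⊆p∪q ⁅ a ⁆ (q⊆p∪q B C z∈C)
    ...   | inj₂ z∈D = p⊆p∪q ⁅ a ⁆ (p⊆p∪q C ([ flip contradiction z∉A∩D , proj₁ ∘ x∈p∩q⁻ B D ]′ (split-D z∈D)))

    E′─[B∩D]⊆ : E′ ─ (B ∩ D) ⊆ A ∪ C
    E′─[B∩D]⊆ {z} z∈ with x∈p─q⁻ E′ (B ∩ D) z∈ | z ≟ f
    ... | _ | yes refl = q⊆p∪q A C f∈C
    ... | z∈E′ , z∉B∩D | no z≢f with Sf.cover z∈E′ z≢f
    ...   | inj₁ z∈A = p⊆p∪q C z∈A
    ...   | inj₂ z∈B = q⊆p∪q A C ([ proj₂ ∘ x∈p∩q⁻ B C , flip contradiction z∉B∩D ]′ (split-B z∈B))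

    E′─[A∩C]⊆ : E′ ─ (A ∩ C) ⊆ ((B ∪ D) ∪ ⁅ f ⁆) ∪ ⁅ a ⁆
    E′─[A∩C]⊆ {z} z∈ with x∈p─q⁻ E′ (A ∩ C) z∈ | z ≟ a | z ≟ f
    ... | _ | yes refl | _ = y∈p∪⁅y⁆ z
    ... | _ | no _ | yes refl = p⊆p∪q ⁅ a ⁆ (y∈p∪⁅y⁆ z)
    ... | z∈E′ , z∉A∩C | no z≢a | no z≢f = p⊆p∪q ⁅ a ⁆ (p⊆p∪q ⁅ f ⁆ (in-B∪D (Sf.cover z∈E′ z≢f)))
      where
      in-B∪D : z ∈ A ⊎ z ∈ B → z ∈ B ∪ D
      in-B∪D (inj₂ z∈B) = p⊆p∪q D z∈B
      in-B∪D (inj₁ z∈A) = q⊆p∪q B D ([ flip contradiction z∉A∩C , proj₂ ∘ x∈p∩q⁻ A D ]′ (split-A z∈A z≢a))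

    ρ[A∩C]+ρ[E′─B∩D]≤ρA+ρC : ρ (A ∩ C) + ρ (E′ ─ (B ∩ D)) ≤ ρ A + ρ C
    ρ[A∩C]+ρ[E′─B∩D]≤ρA+ρC = ρ-submodular′ (ρ-mono E′─[B∩D]⊆)

    conn′-sum-AD-BC : conn′ (A ∩ D) + conn′ (B ∩ C) ≤ (R + 1) + (R + 1)
    conn′-sum-AD-BC = begin
      conn′ (A ∩ D) + conn′ (B ∩ C)
        ≡⟨ [w+x]+[y+z]≡[w+z]+[y+x] (ρ (A ∩ D)) _ (ρ (B ∩ C)) _ ⟩
      (ρ (A ∩ D) + ρ (E′ ─ (B ∩ C))) + (ρ (B ∩ C) + ρ (E′ ─ (A ∩ D)))
        ≤⟨ +-mono-≤ (ρ-submodular′ (ρ≤-of-∈cl f∈cl[A∪D] E′─[B∩C]⊆))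
                    (ρ-submodular′ (ρ≤-of-∈cl a∈cl[B∪C] E′─[A∩D]⊆)) ⟩
      (ρ A + ρ D) + (ρ B + ρ C)
        ≡⟨ [w+x]+[y+z]≡[w+y]+[z+x] (ρ A) (ρ D) (ρ B) (ρ C) ⟩
      (ρ A + ρ B) + (ρ C + ρ D)
        ≤⟨ +-mono-≤ Sf.rank-sum Sa.rank-sum ⟩
      (R + 1) + (R + 1)   ∎
      where open ≤-Reasoning

    conn′-sum-AC-BD : conn′ (A ∩ C) + conn′ (B ∩ D) ≤ (R + 2) + (R + 1)
    conn′-sum-AC-BD = begin
      conn′ (A ∩ C) + conn′ (B ∩ D)
        ≡⟨ [w+x]+[y+z]≡[w+z]+[y+x] (ρ (A ∩ C)) _ (ρ (B ∩ D)) _ ⟩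
      (ρ (A ∩ C) + ρ (E′ ─ (B ∩ D))) + (ρ (B ∩ D) + ρ (E′ ─ (A ∩ C)))
        ≤⟨ +-mono-≤ ρ[A∩C]+ρ[E′─B∩D]≤ρA+ρC
                    (+-monoʳ-≤ (ρ (B ∩ D)) (≤-trans (ρ≤-of-∈cl a∈cl[B∪D∪f] E′─[A∩C]⊆) (ρ-∪-singleton (B ∪ D) f))) ⟩
      (ρ A + ρ C) + (ρ (B ∩ D) + (ρ (B ∪ D) + 1))
        ≤⟨ ≤-reflexive (cong ((ρ A + ρ C) +_) (rearrange (ρ (B ∩ D)) (ρ (B ∪ D)))) ⟩
      (ρ A + ρ C) + ((ρ (B ∪ D) + ρ (B ∩ D)) + 1)
        ≤⟨ +-monoʳ-≤ (ρ A + ρ C) (+-monoˡ-≤ 1 (ρ-submodular id id)) ⟩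
      (ρ A + ρ C) + ((ρ B + ρ D) + 1)
        ≡⟨ regroup (ρ A) (ρ B) (ρ C) (ρ D) ⟩
      ((ρ A + ρ B) + 1) + (ρ C + ρ D)
        ≤⟨ +-mono-≤ (+-monoˡ-≤ 1 Sf.rank-sum) Sa.rank-sum ⟩
      (R + 1 + 1) + (R + 1)
        ≡⟨ cong (_+ (R + 1)) (+-assoc R 1 1) ⟩
      (R + 2) + (R + 1)   ∎
      where
      open ≤-Reasoning
      rearrange : ∀ t u → t + (u + 1) ≡ (u + t) + 1
      rearrange = solve-∀
      regroup : ∀ a b c d → (a + c) + ((b + d) + 1) ≡ ((a + b) + 1) + (c + d)
      regroup = solve-∀

    B∩C-two⇒A∩D-empty : AtLeastTwo (B ∩ C) → Empty (A ∩ D)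
    B∩C-two⇒A∩D-empty BC-two AD-nonempty = R+2≰R+1 (+-cancelˡ-≤ (R + 1) (R + 2) (R + 1) (begin
      (R + 1) + (R + 2)              ≤⟨ +-mono-≤ (R+1≤conn′ (quadrant Sf.A⊆ Sa.B⊆) AD-nonempty)
                                                 (R+2≤conn′ (quadrant Sf.B⊆ Sa.A⊆) BC-two) ⟩
      conn′ (A ∩ D) + conn′ (B ∩ C)  ≤⟨ conn′-sum-AD-BC ⟩
      (R + 1) + (R + 1)              ∎))
      where open ≤-Reasoning

    A∩D-two⇒B∩C-empty : AtLeastTwo (A ∩ D) → Empty (B ∩ C)
    A∩D-two⇒B∩C-empty AD-two BC-nonempty = R+2≰R+1 (+-cancelʳ-≤ (R + 1) (R + 2) (R + 1) (begin
      (R + 2) + (R + 1)              ≤⟨ +-mono-≤ (R+2≤conn′ (quadrant Sf.A⊆ Sa.B⊆) AD-two)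
                                                 (R+1≤conn′ (quadrant Sf.B⊆ Sa.A⊆) BC-nonempty) ⟩
      conn′ (A ∩ D) + conn′ (B ∩ C)  ≤⟨ conn′-sum-AD-BC ⟩
      (R + 1) + (R + 1)              ∎))
      where open ≤-Reasoning

    ¬A∩C-two×B∩D-two : AtLeastTwo (A ∩ C) → ¬ AtLeastTwo (B ∩ D)
    ¬A∩C-two×B∩D-two AC-two BD-two = R+2≰R+1 (+-cancelˡ-≤ (R + 2) (R + 2) (R + 1) (begin
      (R + 2) + (R + 2)              ≤⟨ +-mono-≤ (R+2≤conn′ (quadrant Sf.A⊆ Sa.A⊆) AC-two)
                                                 (R+2≤conn′ (quadrant Sf.B⊆ Sa.B⊆) BD-two) ⟩
      conn′ (A ∩ C) + conn′ (B ∩ D)  ≤⟨ conn′-sum-AC-BD ⟩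
      (R + 2) + (R + 1)              ∎))
      where open ≤-Reasoning

    B∩D-two : AtLeastTwo (B ∩ D)
    B∩D-two with sizeView (B ∩ D)
    ... | two BD-two = BD-two
    ... | empty BD-empty = contradiction (b , x∈p∩q⁺ (b∈B , b∈D)) BD-empty
    -- If B ∩ D = {b}, then B - b ⊆ B ∩ C, so A ∩ D is empty and D ⊆ {b}.
    ... | singleton {t} _ only-t = let u , v , u≢v , u∈D , v∈D = Sa.B-two in
                               ⊥-elim (u≢v (trans (D-trivial u∈D) (sym (D-trivial v∈D))))
      where
      B-b⊆B∩C : B - b ⊆ B ∩ C
      B-b⊆B∩C z∈ with x∈p-y⁻ z∈
      ... | z∈B , z≢b = [ id , (λ z∈BD → contradiction (trans (only-t z∈BD) (sym (only-t (x∈p∩q⁺ (b∈B , b∈D))))) z≢b) ]′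
                          (split-B z∈B)
      D-trivial : ∀ {z} → z ∈ D → z ≡ t
      D-trivial z∈D = [ (λ z∈AD → contradiction (_ , z∈AD) (B∩C-two⇒A∩D-empty (AtLeastTwo-mono B-b⊆B∩C B-b-two))) , only-t ]′
                        (split-D z∈D)

    A-a⊆A∩D : Empty (A ∩ C) → A - a ⊆ A ∩ D
    A-a⊆A∩D AC-empty z∈ = let z∈A , z≢a = x∈p-y⁻ z∈ in
      [ (λ z∈AC → contradiction (_ , z∈AC) AC-empty) , id ]′ (split-A z∈A z≢a)

    C-f⊆B∩C : Empty (A ∩ C) → C - f ⊆ B ∩ C
    C-f⊆B∩C AC-empty z∈ = let z∈C , z≢f = x∈p-y⁻ z∈ in
      [ (λ z∈AC → contradiction (_ , z∈AC) AC-empty) , id ]′ (split-C z∈C z≢f)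

    A∩C-singleton : ∃[ p ] p ∈ A ∩ C × (∀ {z} → z ∈ A ∩ C → z ≡ p)
    A∩C-singleton with sizeView (A ∩ C)
    ... | singleton p∈ only-p = _ , p∈ , only-p
    ... | two AC-two = contradiction B∩D-two (¬A∩C-two×B∩D-two AC-two)
    ... | empty AC-empty =
      let w , _ , _ , w∈ , _ = C-f-two in
      contradiction (w , C-f⊆B∩C AC-empty w∈) (A∩D-two⇒B∩C-empty (AtLeastTwo-mono (A-a⊆A∩D AC-empty) A-a-two))

    module _ {p : Fin n} (p∈A∩C : p ∈ A ∩ C) (only-p : ∀ {z} → z ∈ A ∩ C → z ≡ p) where

      ∉A∩C : ∀ {z} → z ≢ p → z ∉ A ∩ C
      ∉A∩C z≢p z∈AC = z≢p (only-p z∈AC)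

      A∩D-nonempty : Nonempty (A ∩ D)
      A∩D-nonempty = let z , z∈ , z≢p = AtLeastTwo⇒∃≢ A-a-two p ; z∈A , z≢a = x∈p-y⁻ z∈ in
        z , [ flip contradiction (∉A∩C z≢p) , id ]′ (split-A z∈A z≢a)

      B∩C-nonempty : Nonempty (B ∩ C)
      B∩C-nonempty = let z , z∈ , z≢p = AtLeastTwo⇒∃≢ C-f-two p ; z∈C , z≢f = x∈p-y⁻ z∈ in
        z , [ flip contradiction (∉A∩C z≢p) , id ]′ (split-C z∈C z≢f)

      A-a⊆p∪ : ∀ {q} → (∀ {z} → z ∈ A ∩ D → z ≡ q) → A - a ⊆ ⁅ p ⁆ ∪ ⁅ q ⁆
      A-a⊆p∪ only-q z∈ = let z∈A , z≢a = x∈p-y⁻ z∈ in x∈⁅u⁆∪⁅v⁆⁺ (⊎-map only-p only-q (split-A z∈A z≢a))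

      C-f⊆p∪ : ∀ {s} → (∀ {z} → z ∈ B ∩ C → z ≡ s) → C - f ⊆ ⁅ p ⁆ ∪ ⁅ s ⁆
      C-f⊆p∪ only-s z∈ = let z∈C , z≢f = x∈p-y⁻ z∈ in x∈⁅u⁆∪⁅v⁆⁺ (⊎-map only-p only-s (split-C z∈C z≢f))

      ρA≤2 : ρ A ≤ 2
      ρA≤2 = let q , only-q = ¬AtLeastTwo⇒singleton A∩D-nonempty (flip A∩D-two⇒B∩C-empty B∩C-nonempty) in
        ≤-trans ρA≤ρ[A-a] (≤-trans (ρ-mono (A-a⊆p∪ only-q)) (ρ-pair≤2 p q))

      ρC≤2 : ρ C ≤ 2
      ρC≤2 = let s , only-s = ¬AtLeastTwo⇒singleton B∩C-nonempty (flip B∩C-two⇒A∩D-empty A∩D-nonempty) in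
        ≤-trans ρC≤ρ[C-f] (≤-trans (ρ-mono (C-f⊆p∪ only-s)) (ρ-pair≤2 p s))

      p∈E′ : p ∈ E′
      p∈E′ = proj₁ (quadrant Sf.A⊆ Sa.A⊆ p∈A∩C)

      R≰ρ[B∪D] : ¬ R ≤ ρ (B ∪ D)
      R≰ρ[B∪D] R≤ρ[B∪D] = contradiction (+-cancelˡ-≤ (ρ (B ∩ D)) 4 3 (begin
        ρ (B ∩ D) + 4                            ≡⟨ sym (+-assoc (ρ (B ∩ D)) 2 2) ⟩
        ρ (B ∩ D) + 2 + 2                        ≤⟨ +-monoˡ-≤ 2 ρ[B∩D]+2≤R ⟩
        R + 2                                    ≤⟨ R+2≤conn′ (quadrant Sf.B⊆ Sa.B⊆) B∩D-two ⟩
        ρ (B ∩ D) + ρ (E′ ─ (B ∩ D))             ≤⟨ +-monoʳ-≤ (ρ (B ∩ D)) ρ[E′─B∩D]≤3 ⟩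
        ρ (B ∩ D) + 3                            ∎))
        λ { (s≤s (s≤s (s≤s ()))) }
        where
        open ≤-Reasoning
        x+y+2≡1+x+1+y : ∀ x y → x + y + 2 ≡ suc x + suc y
        x+y+2≡1+x+1+y = solve-∀
        ρ[B∩D]+2≤R : ρ (B ∩ D) + 2 ≤ R
        ρ[B∩D]+2≤R = +-cancelˡ-≤ R (ρ (B ∩ D) + 2) R (begin
          R + (ρ (B ∩ D) + 2)                    ≤⟨ +-monoˡ-≤ (ρ (B ∩ D) + 2) R≤ρ[B∪D] ⟩
          ρ (B ∪ D) + (ρ (B ∩ D) + 2)            ≡⟨ sym (+-assoc (ρ (B ∪ D)) (ρ (B ∩ D)) 2) ⟩
          ρ (B ∪ D) + ρ (B ∩ D) + 2              ≤⟨ +-monoˡ-≤ 2 (ρ-submodular id id) ⟩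
          ρ B + ρ D + 2                          ≡⟨ x+y+2≡1+x+1+y (ρ B) (ρ D) ⟩
          suc (ρ B) + suc (ρ D)                  ≤⟨ +-mono-≤ Sf.ρB<R Sa.ρB<R ⟩
          R + R                                  ∎)
        ρ[E′─B∩D]≤3 : ρ (E′ ─ (B ∩ D)) ≤ 3
        ρ[E′─B∩D]≤3 = +-cancelˡ-≤ 1 _ 3 (begin
          1 + ρ (E′ ─ (B ∩ D))                   ≤⟨ +-monoˡ-≤ _ (1≤ρ p∈E′ p∈A∩C) ⟩
          ρ (A ∩ C) + ρ (E′ ─ (B ∩ D))           ≤⟨ ρ[A∩C]+ρ[E′─B∩D]≤ρA+ρC ⟩
          ρ A + ρ C                              ≤⟨ +-mono-≤ ρA≤2 ρC≤2 ⟩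
          4                                      ∎)

      quad-of-A∩C-singleton : QuadAcross f (⁅ a ⁆ ∪ ⁅ b ⁆)
      quad-of-A∩C-singleton with ρ (B ∪ D) <? R
      ... | no ρ[B∪D]≮R = contradiction (≮⇒≥ ρ[B∪D]≮R) R≰ρ[B∪D]
      ... | yes ρ[B∪D]<R =
        quad-across (y∈⁅y⁆∪p a) p∈E′ p≢f (x∉⁅y⁆∪p p≢a (x≢y⇒x∉⁅y⁆ p≢b)) (B ∪ D , ρ[B∪D]<R , B∪D-covers)
        where
        p≢a : p ≢ a
        p≢a = proj₁ (proj₂ (quadrant Sf.A⊆ Sa.A⊆ p∈A∩C))
        p≢f : p ≢ f
        p≢f = proj₂ (proj₂ (quadrant Sf.A⊆ Sa.A⊆ p∈A∩C))
        p≢b : p ≢ b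
        p≢b refl = Sf.disjoint (proj₁ (x∈p∩q⁻ A C p∈A∩C)) b∈B
        B∪D-covers : ∀ {z} → z ∈ E′ → z ≢ f → z ≢ a → z ≢ p → z ∈ B ∪ D
        B∪D-covers z∈E′ z≢f z≢a z≢p with Sf.cover z∈E′ z≢f
        ... | inj₂ z∈B = p⊆p∪q D z∈B
        ... | inj₁ z∈A = q⊆p∪q B D ([ flip contradiction (∉A∩C z≢p) , proj₂ ∘ x∈p∩q⁻ A D ]′ (split-A z∈A z≢a))

    quad : QuadAcross f (⁅ a ⁆ ∪ ⁅ b ⁆)
    quad = let _ , p∈A∩C , only-p = A∩C-singleton in quad-of-A∩C-singleton p∈A∩C only-p

  module Triangle
    {a b f : Fin n} {A B : Subset n}
    (a∈E′ : a ∈ E′) (b∈E′ : b ∈ E′) (f∈E′ : f ∈ E′) (a≢f : a ≢ f) (b≢f : b ≢ f)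
    (line : ρ (⁅ a ⁆ ∪ ⁅ b ⁆ ∪ ⁅ f ⁆) ≤ 2)
    (sep-f : TwoSeparation f A B) (a∈A : a ∈ A) (b∈B : b ∈ B)
    (¬3conn-a : ¬ ThreeConnected (E ─ (⁅ e ⁆ ∪ ⁅ a ⁆)) r)
    where

    module Sf = TwoSeparation sep-f

    a∈ab : a ∈ ⁅ a ⁆ ∪ ⁅ b ⁆
    a∈ab = y∈⁅y⁆∪p a

    ∉ab : ∀ {h} → h ≢ a → h ≢ b → h ∉ ⁅ a ⁆ ∪ ⁅ b ⁆
    ∉ab h≢a h≢b = x∉⁅y⁆∪p h≢a (x≢y⇒x∉⁅y⁆ h≢b)

    b≢a : b ≢ a
    b≢a refl = Sf.disjoint a∈A b∈B

    open Line a∈E′ b∈E′ f∈E′ (b≢a ∘ sym) b≢f line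

    separation-at-a : ∃[ C ] ∃[ D ] TwoSeparation a C D × f ∈ C × b ∈ D
    separation-at-a with two-separation a∈E′ ¬3conn-a
    ... | C , D , sep-a with TwoSeparation.cover sep-a f∈E′ (a≢f ∘ sym) | TwoSeparation.cover sep-a b∈E′ b≢a
    ...   | inj₁ f∈C | inj₂ b∈D = C , D , sep-a , f∈C , b∈D
    ...   | inj₂ f∈D | inj₁ b∈C = D , C , swap-separation sep-a , f∈D , b∈C
    ...   | inj₁ f∈C | inj₁ b∈C = ⊥-elim (d∉clA sep-a a∈E′ (a∈cl b∈C f∈C))
    ...   | inj₂ f∈D | inj₂ b∈D = ⊥-elim (d∉clA (swap-separation sep-a) a∈E′ (a∈cl b∈D f∈D))

    quad : QuadAcross f (⁅ a ⁆ ∪ ⁅ b ⁆)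
    quad with pair-or-two-rest Sf.A-two a | pair-or-two-rest Sf.B-two b
    ... | inj₁ (h , h≢a , h∈A , A⊆ah) | _ =
      quad-across a∈ab (Sf.A⊆E′ h∈A) (proj₂ (Sf.A⊆ h∈A)) (∉ab h≢a (λ { refl → Sf.disjoint h∈A b∈B }))
        (pair-side-codependent sep-f A⊆ah)
    ... | _ | inj₁ (h , h≢b , h∈B , B⊆bh) =
      quad-across (v∈⁅u⁆∪⁅v⁆ a b) (Sf.B⊆E′ h∈B) (proj₂ (Sf.B⊆ h∈B)) (∉ab (λ { refl → Sf.disjoint a∈A h∈B }) h≢b)
        (pair-side-codependent (swap-separation sep-f) B⊆bh)
    ... | inj₂ A-a-two | inj₂ B-b-two with separation-at-a
    ...   | C , D , sep-a , f∈C , b∈D with pair-or-two-rest (TwoSeparation.A-two sep-a) f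
    ...     | inj₁ (h , h≢f , h∈C , C⊆fh) =
      quad-across a∈ab (Sa.A⊆E′ h∈C) h≢f (∉ab (proj₂ (Sa.A⊆ h∈C)) (λ { refl → Sa.disjoint h∈C b∈D }))
        (QuadCoDependent-swap₁₂ (pair-side-codependent sep-a C⊆fh))
      where module Sa = TwoSeparation sep-a
    ...     | inj₂ C-f-two = Uncrossing.quad a∈E′ b∈E′ f∈E′ a≢f b≢f line sep-f sep-a a∈A b∈B f∈C b∈D
      A-a-two (ρA≤ρ[A-x] sep-f f∈E′ a∈A (a∈cl (p⊆p∪q ⁅ f ⁆ b∈B) (y∈p∪⁅y⁆ f)) A-a-two)
      B-b-two
      C-f-two (ρA≤ρ[A-x] sep-a a∈E′ f∈C (f∈cl (y∈p∪⁅y⁆ a) (p⊆p∪q ⁅ a ⁆ b∈D)) C-f-two)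

  -- (X ∪ f, Y) is a 3-separation of N with f in its guts.
  record GutsSeparation (f : Fin n) (X Y : Subset n) : Set where
    field
      partition : Partition f X Y
      f∈clX : f ∈cl X
      f∈clY : f ∈cl Y
      rank-sum : ρ X + ρ Y ≤ R + 2

    open Partition partition public

  swap-guts : ∀ {X Y} → GutsSeparation f X Y → GutsSeparation f Y X
  swap-guts {X = X} {Y} guts = record
    { partition = swap-partition partition ; f∈clX = f∈clY ; f∈clY = f∈clX
    ; rank-sum = ≤-trans (≤-reflexive (+-comm (ρ Y) (ρ X))) rank-sum }
    where open GutsSeparation guts

  QuadAcross-cong : ∀ {X X′} → X ⊆ X′ → X′ ⊆ X → QuadAcross f X → QuadAcross f X′
  QuadAcross-cong X⊆X′ X′⊆X (quad-across g∈X h∈E′ h≢f h∉X codependent) =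
    quad-across (X⊆X′ g∈X) h∈E′ h≢f (h∉X ∘ X′⊆X) codependent

  QuadAcross-other-side : ∀ {X Y} → Partition f X Y → QuadAcross f Y → QuadAcross f X
  QuadAcross-other-side P (quad-across g∈Y h∈E′ h≢f h∉Y codependent) =
    quad-across (∉B⇒∈A h∈E′ h≢f h∉Y) (B⊆E′ g∈Y) (proj₂ (B⊆ g∈Y)) (flip disjoint g∈Y)
      (QuadCoDependent-swap₂₃ codependent)
    where open Partition P

  side-meets : TwoSeparation f A B → f ∈ E′ → (∀ {x} → x ∈ Z → x ∈ E′ × x ≢ f) → f ∈cl Z → Nonempty (B ∩ Z)
  side-meets {f} {A} {B} {Z} sep f∈E′ Z⊆ f∈clZ with nonempty? (B ∩ Z)
  ... | yes BZ-nonempty = BZ-nonempty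
  ... | no BZ-empty = contradiction (∈cl-mono Z⊆A f∈clZ) (d∉clA sep f∈E′)
    where
    open TwoSeparation sep
    Z⊆A : Z ⊆ A
    Z⊆A z∈Z = ∉B⇒∈A (proj₁ (Z⊆ z∈Z)) (proj₂ (Z⊆ z∈Z)) (λ z∈B → BZ-empty (_ , x∈p∩q⁺ (z∈B , z∈Z)))

  R+2≤ρ[A∩X]+ρ[B∪Y] : ∀ {X Y} → TwoSeparation f A B → GutsSeparation f X Y →
                       AtLeastTwo (A ∩ X) → AtLeastTwo (B ∩ Y) → R + 2 ≤ ρ (A ∩ X) + ρ (B ∪ Y)
  R+2≤ρ[A∩X]+ρ[B∪Y] {f} {A} {B} {X} {Y} sep guts AX-two (u , v , u≢v , u∈BY , v∈BY) = ≤-trans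
    (ρ-sum≥R+2 (AtLeastTwo-mono (λ z∈ → x∈p∩q⁺ (S.A⊆E′ (proj₁ (x∈p∩q⁻ A X z∈)) , z∈)) AX-two)
               (u , v , u≢v , B∩Y⊆E′─A∩X u∈BY , B∩Y⊆E′─A∩X v∈BY) E′─[A∩X]⊆)
    (+-monoʳ-≤ (ρ (A ∩ X)) (∈cl-mono (q⊆p∪q B Y) G.f∈clY))
    where
    module S = TwoSeparation sep
    module G = GutsSeparation guts
    B∩Y⊆E′─A∩X : B ∩ Y ⊆ E′ ─ (A ∩ X)
    B∩Y⊆E′─A∩X z∈ = let z∈B = proj₁ (x∈p∩q⁻ B Y z∈) in
      x∈p∧x∉q⇒x∈p─q (S.B⊆E′ z∈B) (λ z∈AX → S.disjoint (proj₁ (x∈p∩q⁻ A X z∈AX)) z∈B)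
    E′─[A∩X]⊆ : E′ ─ (A ∩ X) ⊆ (B ∪ Y) ∪ ⁅ f ⁆
    E′─[A∩X]⊆ {z} z∈ with x∈p─q⁻ E′ (A ∩ X) z∈ | z ≟ f
    ... | _ | yes refl = y∈p∪⁅y⁆ z
    ... | z∈E′ , z∉AX | no z≢f = p⊆p∪q ⁅ f ⁆ ([ in-Y , p⊆p∪q Y ]′ (S.cover z∈E′ z≢f))
      where
      in-Y : z ∈ A → z ∈ B ∪ Y
      in-Y z∈A = q⊆p∪q B Y (G.∉A⇒∈B z∈E′ z≢f (λ z∈X → z∉AX (x∈p∩q⁺ (z∈A , z∈X))))

  ¬AtLeastTwo-crossing : ∀ {X Y} → TwoSeparation f A B → GutsSeparation f X Y →
                         AtLeastTwo (A ∩ X) → ¬ AtLeastTwo (B ∩ Y)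
  ¬AtLeastTwo-crossing {A = A} {B} {X} {Y} sep guts AX-two BY-two =
    R+2≰R+1 (+-cancelʳ-≤ (R + 2) (R + 2) (R + 1) (begin
      (R + 2) + (R + 2)
        ≤⟨ +-mono-≤ (R+2≤ρ[A∩X]+ρ[B∪Y] sep guts AX-two BY-two)
                    (R+2≤ρ[A∩X]+ρ[B∪Y] (swap-separation sep) (swap-guts guts) BY-two AX-two) ⟩
      (ρ (A ∩ X) + ρ (B ∪ Y)) + (ρ (B ∩ Y) + ρ (A ∪ X))
        ≡⟨ [w+x]+[y+z]≡[w+z]+[y+x] (ρ (A ∩ X)) _ (ρ (B ∩ Y)) _ ⟩
      (ρ (A ∩ X) + ρ (A ∪ X)) + (ρ (B ∩ Y) + ρ (B ∪ Y))
        ≤⟨ +-mono-≤ (ρ-submodular′ ≤-refl) (ρ-submodular′ ≤-refl) ⟩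
      (ρ A + ρ X) + (ρ B + ρ Y)
        ≡⟨ interchange (ρ A) (ρ X) (ρ B) (ρ Y) ⟩
      (ρ A + ρ B) + (ρ X + ρ Y)
        ≤⟨ +-mono-≤ (TwoSeparation.rank-sum sep) (GutsSeparation.rank-sum guts) ⟩
      (R + 1) + (R + 2)   ∎))
    where open ≤-Reasoning

  QuadAcross-side-pair : ∀ {X Y} → TwoSeparation f A B → GutsSeparation f X Y → u ∈ A ∩ X → v ∈ A ∩ Y →
                         (∀ {z} → z ∈ A ∩ X → z ≡ u) → (∀ {z} → z ∈ A ∩ Y → z ≡ v) → QuadAcross f X
  QuadAcross-side-pair {A = A} {u = u} {v} {X} {Y} sep guts u∈AX v∈AY only-u only-v =
    quad-across (proj₂ (x∈p∩q⁻ A X u∈AX)) (G.B⊆E′ v∈Y) (proj₂ (G.B⊆ v∈Y)) (flip G.disjoint v∈Y)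
      (pair-side-codependent sep A⊆uv)
    where
    module S = TwoSeparation sep
    module G = GutsSeparation guts
    v∈Y : v ∈ Y
    v∈Y = proj₂ (x∈p∩q⁻ A Y v∈AY)
    A⊆uv : A ⊆ ⁅ u ⁆ ∪ ⁅ v ⁆
    A⊆uv z∈A = x∈⁅u⁆∪⁅v⁆⁺ (⊎-map (only-u ∘ x∈p∩q⁺ ∘ (z∈A ,_)) (only-v ∘ x∈p∩q⁺ ∘ (z∈A ,_))
                                         (G.cover (S.A⊆E′ z∈A) (proj₂ (S.A⊆ z∈A))))

  QuadAcross-guts-pair : ∀ {X Y} → f ∈ E′ → TwoSeparation f A B → GutsSeparation f X Y →
                         a ∈ A ∩ X → b ∈ B ∩ X →
                         (∀ {z} → z ∈ A ∩ X → z ≡ a) → (∀ {z} → z ∈ B ∩ X → z ≡ b) →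
                         ¬ ThreeConnected (E ─ (⁅ e ⁆ ∪ ⁅ a ⁆)) r → QuadAcross f X
  QuadAcross-guts-pair {f} {A} {B} {a} {b} {X} f∈E′ sep guts a∈AX b∈BX only-a only-b ¬3conn-a =
    QuadAcross-cong ab⊆X X⊆ab
      (Triangle.quad (G.A⊆E′ a∈X) (G.A⊆E′ b∈X) f∈E′ (proj₂ (G.A⊆ a∈X)) (proj₂ (G.A⊆ b∈X)) line sep a∈A b∈B ¬3conn-a)
    where
    module S = TwoSeparation sep
    module G = GutsSeparation guts
    a∈A : a ∈ A
    a∈A = proj₁ (x∈p∩q⁻ A X a∈AX)
    a∈X : a ∈ X
    a∈X = proj₂ (x∈p∩q⁻ A X a∈AX)
    b∈B : b ∈ B
    b∈B = proj₁ (x∈p∩q⁻ B X b∈BX)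
    b∈X : b ∈ X
    b∈X = proj₂ (x∈p∩q⁻ B X b∈BX)
    X⊆ab : X ⊆ ⁅ a ⁆ ∪ ⁅ b ⁆
    X⊆ab z∈X = x∈⁅u⁆∪⁅v⁆⁺ (⊎-map (only-a ∘ x∈p∩q⁺ ∘ (_, z∈X)) (only-b ∘ x∈p∩q⁺ ∘ (_, z∈X))
                                         (S.cover (G.A⊆E′ z∈X) (proj₂ (G.A⊆ z∈X))))
    ab⊆X : ⁅ a ⁆ ∪ ⁅ b ⁆ ⊆ X
    ab⊆X z∈ = [ (λ { refl → a∈X }) , (λ { refl → b∈X }) ]′ (x∈⁅u⁆∪⁅v⁆⁻ z∈)
    abf⊆X∪f : ⁅ a ⁆ ∪ ⁅ b ⁆ ∪ ⁅ f ⁆ ⊆ X ∪ ⁅ f ⁆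
    abf⊆X∪f z∈ with x∈⁅y⁆∪p⁻ z∈
    ... | inj₁ refl = p⊆p∪q ⁅ f ⁆ a∈X
    ... | inj₂ z∈bf = [ (λ { refl → p⊆p∪q ⁅ f ⁆ b∈X }) , (λ { refl → y∈p∪⁅y⁆ f }) ]′ (x∈⁅u⁆∪⁅v⁆⁻ z∈bf)
    line : ρ (⁅ a ⁆ ∪ ⁅ b ⁆ ∪ ⁅ f ⁆) ≤ 2
    line = ≤-trans (ρ-mono abf⊆X∪f) (≤-trans G.f∈clX (≤-trans (ρ-mono X⊆ab) (ρ-pair≤2 a b)))

  QuadAcross-of-guts : ∀ {X Y} → f ∈ E′ → GutsSeparation f X Y →
                       (∀ {d} → d ∈ E′ → ¬ ThreeConnected (E ─ (⁅ e ⁆ ∪ ⁅ d ⁆)) r) → QuadAcross f X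
  -- All four quadrants are nonempty, and by ¬AtLeastTwo-crossing two quadrants sharing a side of
  -- (A, B) or of (X, Y) are singletons.
  QuadAcross-of-guts {f} {X} {Y} f∈E′ guts ¬3conn with two-separation f∈E′ (¬3conn f∈E′)
  ... | A , B , sep
    with singleton⊎AtLeastTwo (side-meets (swap-separation sep) f∈E′ G.A⊆ G.f∈clX)
       | singleton⊎AtLeastTwo (side-meets (swap-separation sep) f∈E′ G.B⊆ G.f∈clY)
       | singleton⊎AtLeastTwo (side-meets sep f∈E′ G.A⊆ G.f∈clX)
       | singleton⊎AtLeastTwo (side-meets sep f∈E′ G.B⊆ G.f∈clY)
    where module G = GutsSeparation guts
  ... | inj₁ (_ , u∈AX , only-u) | inj₁ (_ , v∈AY , only-v) | _ | _ =
    QuadAcross-side-pair sep guts u∈AX v∈AY only-u only-v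
  ... | _ | _ | inj₁ (_ , u∈BX , only-u) | inj₁ (_ , v∈BY , only-v) =
    QuadAcross-side-pair (swap-separation sep) guts u∈BX v∈BY only-u only-v
  ... | inj₁ (_ , a∈AX , only-a) | _ | inj₁ (_ , b∈BX , only-b) | _ =
    QuadAcross-guts-pair f∈E′ sep guts a∈AX b∈BX only-a only-b
      (¬3conn (GutsSeparation.A⊆E′ guts (proj₂ (x∈p∩q⁻ A X a∈AX))))
  ... | _ | inj₁ (_ , a∈AY , only-a) | _ | inj₁ (_ , b∈BY , only-b) =
    QuadAcross-other-side (GutsSeparation.partition guts)
      (QuadAcross-guts-pair f∈E′ sep (swap-guts guts) a∈AY b∈BY only-a only-b
        (¬3conn (GutsSeparation.B⊆E′ guts (proj₂ (x∈p∩q⁻ A Y a∈AY)))))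
  ... | inj₂ AX-two | _ | _ | inj₂ BY-two = contradiction BY-two (¬AtLeastTwo-crossing sep guts AX-two)
  ... | _ | inj₂ AY-two | inj₂ BX-two | _ = contradiction BX-two (¬AtLeastTwo-crossing sep (swap-guts guts) AY-two)

  -- Cocircuits

  R≤ρ-of-pair : R + 2 ≤ ρ (⁅ u ⁆ ∪ ⁅ v ⁆) + ρ Z → R ≤ ρ Z
  R≤ρ-of-pair {u} {v} {Z} R+2≤ = +-cancelʳ-≤ 2 R (ρ Z) (begin
    R + 2                     ≤⟨ R+2≤ ⟩
    ρ (⁅ u ⁆ ∪ ⁅ v ⁆) + ρ Z   ≤⟨ +-monoˡ-≤ (ρ Z) (ρ-pair≤2 u v) ⟩
    2 + ρ Z                   ≡⟨ +-comm 2 (ρ Z) ⟩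
    ρ Z + 2                   ∎)
    where open ≤-Reasoning

  ¬CoDependent-pair : u ≢ v → u ∈ E → v ∈ E → ¬ CoDependent E r (⁅ u ⁆ ∪ ⁅ v ⁆)
  ¬CoDependent-pair {u} {v} u≢v u∈E v∈E = ¬CoDependent (R≤ρ-of-pair (MR.ρ-sum≥2 two-in two-out id))
    where
    two-in : AtLeastTwo (E ∩ (⁅ u ⁆ ∪ ⁅ v ⁆))
    two-in = u , v , u≢v , x∈p∩q⁺ (u∈E , y∈⁅y⁆∪p u) , x∈p∩q⁺ (v∈E , v∈⁅u⁆∪⁅v⁆ u v)
    uv⊆uvu : ⁅ u ⁆ ∪ ⁅ v ⁆ ⊆ ⁅ u ⁆ ∪ ⁅ v ⁆ ∪ ⁅ u ⁆
    uv⊆uvu z∈ = [ (λ { refl → x∈⁅x⁆∪⁅y⁆∪⁅z⁆ u v u }) , (λ { refl → y∈⁅x⁆∪⁅y⁆∪⁅z⁆ u v u }) ]′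
                  (x∈⁅u⁆∪⁅v⁆⁻ z∈)
    two-out : AtLeastTwo (E ─ (⁅ u ⁆ ∪ ⁅ v ⁆))
    two-out = AtLeastTwo-mono (p─q⊆p─r uv⊆uvu) (two-outside u v u)

  ¬CoDependent-with-e : u ≢ v → u ∈ E′ → v ∈ E′ → ¬ CoDependent E r (⁅ e ⁆ ∪ ⁅ u ⁆ ∪ ⁅ v ⁆)
  ¬CoDependent-with-e {u} {v} u≢v u∈E′ v∈E′ = ¬CoDependent (R≤ρ-of-pair
    (ρ-sum≥R+2 two-in (two-outside-E′ u v) (⊆-reflexive (p─q─r≡p─q∪r E ⁅ e ⁆ (⁅ u ⁆ ∪ ⁅ v ⁆)))))
    where
    two-in : AtLeastTwo (E′ ∩ (⁅ u ⁆ ∪ ⁅ v ⁆))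
    two-in = u , v , u≢v , x∈p∩q⁺ (u∈E′ , y∈⁅y⁆∪p u) , x∈p∩q⁺ (v∈E′ , v∈⁅u⁆∪⁅v⁆ u v)

  triad : ∀ {c} → a ≢ b → a ≢ c → b ≢ c → a ∈ E → b ∈ E → c ∈ E →
          CoDependent E r (⁅ a ⁆ ∪ ⁅ b ⁆ ∪ ⁅ c ⁆) → Triad E r (⁅ a ⁆ ∪ ⁅ b ⁆ ∪ ⁅ c ⁆)
  triad {a} {b} {c} a≢b a≢c b≢c a∈E b∈E c∈E codependent =
    cocircuit abc⊆E (a , x∈⁅x⁆∪⁅y⁆∪⁅z⁆ a b c) codependent ¬codependent-minus ,
    ∣⁅a⁆∪⁅b⁆∪⁅c⁆∣≡3 a≢b a≢c b≢c
    where
    abc⊆E : ⁅ a ⁆ ∪ ⁅ b ⁆ ∪ ⁅ c ⁆ ⊆ E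
    abc⊆E x∈ = [ (λ { refl → a∈E }) , [ (λ { refl → b∈E }) , (λ { refl → c∈E }) ]′ ]′ (x∈⁅a⁆∪⁅b⁆∪⁅c⁆⁻ x∈)
    ¬codependent-minus : ∀ {x} → x ∈ ⁅ a ⁆ ∪ ⁅ b ⁆ ∪ ⁅ c ⁆ → ¬ CoDependent E r (⁅ a ⁆ ∪ ⁅ b ⁆ ∪ ⁅ c ⁆ - x)
    ¬codependent-minus x∈ with x∈⁅a⁆∪⁅b⁆∪⁅c⁆⁻ x∈
    ... | inj₁ refl = ¬CoDependent-pair b≢c b∈E c∈E ∘ CoDependent-mono ⁅x⁆∪p-x⊆p
    ... | inj₂ (inj₁ refl) = ¬CoDependent-pair a≢c a∈E c∈E ∘ CoDependent-mono (p-x⊆q λ y∈ y≢b →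
      case x∈⁅a⁆∪⁅b⁆∪⁅c⁆⁻ y∈ of λ where
        (inj₁ refl)        → y∈⁅y⁆∪p a
        (inj₂ (inj₁ refl)) → ⊥-elim (y≢b refl)
        (inj₂ (inj₂ refl)) → v∈⁅u⁆∪⁅v⁆ a c)
    ... | inj₂ (inj₂ refl) = ¬CoDependent-pair a≢b a∈E b∈E ∘ CoDependent-mono (p-x⊆q λ y∈ y≢c →
      case x∈⁅a⁆∪⁅b⁆∪⁅c⁆⁻ y∈ of λ where
        (inj₁ refl)        → y∈⁅y⁆∪p a
        (inj₂ (inj₁ refl)) → v∈⁅u⁆∪⁅v⁆ a b
        (inj₂ (inj₂ refl)) → ⊥-elim (y≢c refl))

  QuadCoDependent⇒cocircuit : ∀ {g h} → f ∈ E′ → g ∈ E′ → h ∈ E′ → f ≢ g → f ≢ h → g ≢ h →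
                              (∀ T → Triad E r T → f ∉ T) → QuadCoDependent f g h →
                              Cocircuit E r (⁅ e ⁆ ∪ ⁅ f ⁆ ∪ ⁅ g ⁆ ∪ ⁅ h ⁆) ×
                              ∣ ⁅ e ⁆ ∪ ⁅ f ⁆ ∪ ⁅ g ⁆ ∪ ⁅ h ⁆ ∣ ≡ 4
  QuadCoDependent⇒cocircuit {f} {g} {h} f∈E′ g∈E′ h∈E′ f≢g f≢h g≢h no-triad (H , ρH<R , covers) =
    cocircuit Q⊆E (e , y∈⁅y⁆∪p e) Q-codependent ¬codependent-minus ,
    trans (x∉p⇒∣⁅x⁆∪p∣≡1+∣p∣ e∉fgh) (cong (1 +_) (∣⁅a⁆∪⁅b⁆∪⁅c⁆∣≡3 f≢g f≢h g≢h))
    where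
    Q : Subset n
    Q = ⁅ e ⁆ ∪ ⁅ f ⁆ ∪ ⁅ g ⁆ ∪ ⁅ h ⁆
    f∈E : f ∈ E
    f∈E = proj₁ (x∈p-y⁻ f∈E′)
    g∈E : g ∈ E
    g∈E = proj₁ (x∈p-y⁻ g∈E′)
    h∈E : h ∈ E
    h∈E = proj₁ (x∈p-y⁻ h∈E′)
    e≢f : e ≢ f
    e≢f = proj₂ (x∈p-y⁻ f∈E′) ∘ sym
    e≢g : e ≢ g
    e≢g = proj₂ (x∈p-y⁻ g∈E′) ∘ sym
    e≢h : e ≢ h
    e≢h = proj₂ (x∈p-y⁻ h∈E′) ∘ sym
    e∉fgh : e ∉ ⁅ f ⁆ ∪ ⁅ g ⁆ ∪ ⁅ h ⁆
    e∉fgh = x∉⁅y⁆∪p e≢f (x∉⁅y⁆∪p e≢g (x≢y⇒x∉⁅y⁆ e≢h))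
    Q⊆E : Q ⊆ E
    Q⊆E x∈ = [ (λ { refl → e∈E }) , [ (λ { refl → f∈E }) , [ (λ { refl → g∈E }) , (λ { refl → h∈E }) ]′ ]′ ]′
                (x∈⁅a⁆∪⁅b⁆∪⁅c⁆∪⁅d⁆⁻ x∈)
    E─Q⊆H : E ─ Q ⊆ H
    E─Q⊆H z∈ with x∈p─q⁻ E Q z∈
    ... | z∈E , z∉Q with x∉⁅y⁆∪p⁻ z∉Q
    ...   | z≢e , z∉fgh with x∉⁅y⁆∪p⁻ z∉fgh
    ...     | z≢f , z∉gh with x∉⁅y⁆∪p⁻ z∉gh
    ...       | z≢g , z∉h = covers (x∈p∧x≢y⇒x∈p-y z∈E z≢e) z≢f z≢g (x∉⁅y⁆⇒x≢y z∉h)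
    Q-codependent : CoDependent E r Q
    Q-codependent = subst₂ _<_ (ρ≡r (p─q⊆p E Q)) (ρ≡r id) (≤-trans (s≤s (ρ-mono E─Q⊆H)) ρH<R)
    ¬triad-with-f : ∀ {u v} → f ≢ u → f ≢ v → u ≢ v → u ∈ E → v ∈ E →
                    ¬ CoDependent E r (⁅ f ⁆ ∪ ⁅ u ⁆ ∪ ⁅ v ⁆)
    ¬triad-with-f {u} {v} f≢u f≢v u≢v u∈E v∈E codependent =
      no-triad _ (triad f≢u f≢v u≢v f∈E u∈E v∈E codependent) (x∈⁅x⁆∪⁅y⁆∪⁅z⁆ f u v)
    ¬codependent-minus : ∀ {x} → x ∈ Q → ¬ CoDependent E r (Q - x)
    ¬codependent-minus x∈ with x∈⁅a⁆∪⁅b⁆∪⁅c⁆∪⁅d⁆⁻ x∈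
    ... | inj₁ refl = ¬triad-with-f f≢g f≢h g≢h g∈E h∈E ∘ CoDependent-mono ⁅x⁆∪p-x⊆p
    ... | inj₂ (inj₁ refl) = ¬CoDependent-with-e g≢h g∈E′ h∈E′ ∘ CoDependent-mono (p-x⊆q λ y∈ y≢f →
      case x∈⁅a⁆∪⁅b⁆∪⁅c⁆∪⁅d⁆⁻ y∈ of λ where
        (inj₁ refl)               → x∈⁅x⁆∪⁅y⁆∪⁅z⁆ e g h
        (inj₂ (inj₁ refl))        → ⊥-elim (y≢f refl)
        (inj₂ (inj₂ (inj₁ refl))) → y∈⁅x⁆∪⁅y⁆∪⁅z⁆ e g h
        (inj₂ (inj₂ (inj₂ refl))) → z∈⁅x⁆∪⁅y⁆∪⁅z⁆ e g h)
    ... | inj₂ (inj₂ (inj₁ refl)) = ¬triad-with-f (e≢f ∘ sym) f≢h e≢h e∈E h∈E ∘ CoDependent-mono (p-x⊆q λ y∈ y≢g →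
      case x∈⁅a⁆∪⁅b⁆∪⁅c⁆∪⁅d⁆⁻ y∈ of λ where
        (inj₁ refl)               → y∈⁅x⁆∪⁅y⁆∪⁅z⁆ f e h
        (inj₂ (inj₁ refl))        → x∈⁅x⁆∪⁅y⁆∪⁅z⁆ f e h
        (inj₂ (inj₂ (inj₁ refl))) → ⊥-elim (y≢g refl)
        (inj₂ (inj₂ (inj₂ refl))) → z∈⁅x⁆∪⁅y⁆∪⁅z⁆ f e h)
    ... | inj₂ (inj₂ (inj₂ refl)) = ¬triad-with-f (e≢f ∘ sym) f≢g e≢g e∈E g∈E ∘ CoDependent-mono (p-x⊆q λ y∈ y≢h →
      case x∈⁅a⁆∪⁅b⁆∪⁅c⁆∪⁅d⁆⁻ y∈ of λ where
        (inj₁ refl)               → y∈⁅x⁆∪⁅y⁆∪⁅z⁆ f e g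
        (inj₂ (inj₁ refl))        → x∈⁅x⁆∪⁅y⁆∪⁅z⁆ f e g
        (inj₂ (inj₂ (inj₁ refl))) → z∈⁅x⁆∪⁅y⁆∪⁅z⁆ f e g
        (inj₂ (inj₂ (inj₂ refl))) → ⊥-elim (y≢h refl))

  deletion-not-3connected : NoDetachablePairs M → ∀ {d} → d ∈ E′ → ¬ ThreeConnected (E ─ (⁅ e ⁆ ∪ ⁅ d ⁆)) r
  deletion-not-3connected no-detachable {d} d∈E′ 3conn =
    let d∈E , d≢e = x∈p-y⁻ d∈E′ in no-detachable e d (e∈E , d∈E , d≢e ∘ sym , inj₁ 3conn)

  module _ {X : Subset n} {f : Fin n} (X⊆E : X ⊆ E) (e∉X : e ∉ X) (f∈E′ : f ∈ E′) (f∉X : f ∉ X) where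

    X⊆E′-f : X ⊆ E′ - f
    X⊆E′-f x∈X = x∈p∧x≢y⇒x∈p-y (x∈p∧x≢y⇒x∈p-y (X⊆E x∈X) (λ { refl → e∉X x∈X })) (λ { refl → f∉X x∈X })

    Y∪f⊆E─[X∪e] : (E′ - f ─ X) ∪ ⁅ f ⁆ ⊆ E ─ (X ∪ ⁅ e ⁆)
    Y∪f⊆E─[X∪e] z∈ with x∈p∪⁅y⁆⁻ z∈
    ... | inj₂ refl = let f∈E , f≢e = x∈p-y⁻ f∈E′ in
      x∈p∧x∉q⇒x∈p─q f∈E ([ f∉X , f≢e ∘ x∈⁅y⁆⇒x≡y e ]′ ∘ x∈p∪q⁻ X ⁅ e ⁆)
    ... | inj₁ z∈Y with x∈p─q⁻ (E′ - f) X z∈Y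
    ...   | z∈E′-f , z∉X = let z∈E , z≢e = x∈p-y⁻ (proj₁ (x∈p-y⁻ z∈E′-f)) in
      x∈p∧x∉q⇒x∈p─q z∈E ([ z∉X , z≢e ∘ x∈⁅y⁆⇒x≡y e ]′ ∘ x∈p∪q⁻ X ⁅ e ⁆)

    ρX+ρ[Y∪f]≤R+2 : conn E r X ≡ 2 ⊎ conn E r (X ∪ ⁅ e ⁆) ≡ 2 → ρ X + ρ ((E′ - f ─ X) ∪ ⁅ f ⁆) ≤ R + 2
    ρX+ρ[Y∪f]≤R+2 (inj₁ λX≡2) = ≤-trans
      (+-monoʳ-≤ (ρ X) (ρ-mono (p─q⊆p─r (p⊆p∪q ⁅ e ⁆) ∘ Y∪f⊆E─[X∪e])))
      (ρ-sum≤R+k 2 id X⊆E (≤-reflexive (cong suc λX≡2)))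
    ρX+ρ[Y∪f]≤R+2 (inj₂ λXe≡2) = ≤-trans
      (+-mono-≤ (ρ-mono (p⊆p∪q ⁅ e ⁆)) (ρ-mono Y∪f⊆E─[X∪e]))
      (ρ-sum≤R+k 2 id Xe⊆E (≤-reflexive (cong suc λXe≡2)))
      where
      Xe⊆E : X ∪ ⁅ e ⁆ ⊆ E
      Xe⊆E z∈ = [ X⊆E , (λ { refl → e∈E }) ]′ (x∈p∪⁅y⁆⁻ z∈)

    2≤∣Y∣ : ∣ X ∣ + 4 ≤ ∣ E ∣ → 2 ≤ ∣ E′ - f ─ X ∣
    2≤∣Y∣ ∣X∣+4≤∣E∣ = ≤-pred (≤-pred (+-cancelˡ-≤ ∣ X ∣ 4 (2 + ∣ Y ∣) (begin
      ∣ X ∣ + 4                        ≤⟨ ∣X∣+4≤∣E∣ ⟩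
      ∣ E ∣                            ≤⟨ ∣p∣≤∣p─q∣+∣q∣ E ⁅ e ⁆ ⟩
      ∣ E′ ∣ + ∣ ⁅ e ⁆ ∣                ≤⟨ +-mono-≤ (∣p∣≤∣p─q∣+∣q∣ E′ ⁅ f ⁆) (≤-reflexive (∣⁅x⁆∣≡1 e)) ⟩
      ∣ E′ - f ∣ + ∣ ⁅ f ⁆ ∣ + 1         ≤⟨ +-monoˡ-≤ 1 (+-mono-≤ (∣p∣≤∣p─q∣+∣q∣ (E′ - f) X) (≤-reflexive (∣⁅x⁆∣≡1 f))) ⟩
      ∣ Y ∣ + ∣ X ∣ + 1 + 1              ≡⟨ regroup ∣ Y ∣ ∣ X ∣ ⟩
      ∣ X ∣ + (2 + ∣ Y ∣)                ∎)))
      where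
      open ≤-Reasoning
      Y : Subset n
      Y = E′ - f ─ X
      regroup : ∀ y x → y + x + 1 + 1 ≡ x + (2 + y)
      regroup = solve-∀

    guts-separation : 2 ≤ ∣ X ∣ → ∣ X ∣ + 4 ≤ ∣ E ∣ → conn E r X ≡ 2 ⊎ conn E r (X ∪ ⁅ e ⁆) ≡ 2 →
                      InClosure E r X f → GutsSeparation f X (E′ - f ─ X)
    guts-separation 2≤∣X∣ ∣X∣+4≤∣E∣ λ≡2 (_ , r[X∪f]≡rX) = record
      { partition = partition ; f∈clX = f∈clX ; f∈clY = f∈clY
      ; rank-sum = ≤-trans (+-monoʳ-≤ (ρ X) (ρ-mono (p⊆p∪q ⁅ f ⁆))) ub }
      where
      Y : Subset n
      Y = E′ - f ─ X
      partition : Partition f X Y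
      partition = complement-partition X⊆E′-f
      open Partition partition
      f∈clX : f ∈cl X
      f∈clX = ≤-reflexive (trans (ρ≡r Xf⊆E) (trans r[X∪f]≡rX (sym (ρ≡r X⊆E))))
        where
        Xf⊆E : X ∪ ⁅ f ⁆ ⊆ E
        Xf⊆E z∈ = [ X⊆E , (λ { refl → proj₁ (x∈p-y⁻ f∈E′) }) ]′ (x∈p∪⁅y⁆⁻ z∈)
      ub : ρ X + ρ (Y ∪ ⁅ f ⁆) ≤ R + 2
      ub = ρX+ρ[Y∪f]≤R+2 λ≡2
      E′─[X∪f]⊆Y : E′ ─ (X ∪ ⁅ f ⁆) ⊆ Y
      E′─[X∪f]⊆Y z∈ = let z∈E′ , z∉Xf = x∈p─q⁻ E′ (X ∪ ⁅ f ⁆) z∈ in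
        x∈p∧x∉q⇒x∈p─q (x∈p∧x≢y⇒x∈p-y z∈E′ (λ { refl → z∉Xf (y∈p∪⁅y⁆ _) })) (z∉Xf ∘ p⊆p∪q ⁅ f ⁆)
      Y⊆E′─[X∪f] : Y ⊆ E′ ─ (X ∪ ⁅ f ⁆)
      Y⊆E′─[X∪f] z∈Y = x∈p∧x∉q⇒x∈p─q (B⊆E′ z∈Y) ([ flip disjoint z∈Y , proj₂ (B⊆ z∈Y) ]′ ∘ x∈p∪⁅y⁆⁻)
      lb : R + 2 ≤ ρ X + ρ Y
      lb = ≤-trans
        (ρ-sum≥R+2 (AtLeastTwo-mono (λ z∈X → x∈p∩q⁺ (A⊆E′ z∈X , p⊆p∪q ⁅ f ⁆ z∈X)) (2≤∣p∣⇒AtLeastTwo 2≤∣X∣))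
                   (AtLeastTwo-mono Y⊆E′─[X∪f] (2≤∣p∣⇒AtLeastTwo (2≤∣Y∣ ∣X∣+4≤∣E∣))) E′─[X∪f]⊆Y)
        (+-monoˡ-≤ (ρ Y) f∈clX)
      f∈clY : f ∈cl Y
      f∈clY = +-cancelˡ-≤ (ρ X) _ _ (≤-trans ub lb)

    QuadAcross⇒cocircuit : (∀ T → Triad E r T → f ∉ T) → QuadAcross f X →
      ∃[ g ] ∃[ h ] (g ∈ X × h ∈ E × h ∉ X ×
        Cocircuit E r (⁅ e ⁆ ∪ ⁅ f ⁆ ∪ ⁅ g ⁆ ∪ ⁅ h ⁆) × ∣ ⁅ e ⁆ ∪ ⁅ f ⁆ ∪ ⁅ g ⁆ ∪ ⁅ h ⁆ ∣ ≡ 4)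
    QuadAcross⇒cocircuit no-triad (quad-across {g} {h} g∈X h∈E′ h≢f h∉X codependent) =
      g , h , g∈X , proj₁ (x∈p-y⁻ h∈E′) , h∉X ,
      QuadCoDependent⇒cocircuit f∈E′ (proj₁ (x∈p-y⁻ (X⊆E′-f g∈X))) h∈E′
        (λ { refl → f∉X g∈X }) (h≢f ∘ sym) (λ { refl → h∉X g∈X }) no-triad codependent

lemma5p2 : {n : ℕ} (M : Matroid n) →
    ThreeConnectedM M → NoDetachablePairs M →
    (X : Subset n) → X ⊆ Matroid.E M → 2 ≤ ∣ X ∣ → ∣ X ∣ + 4 ≤ ∣ Matroid.E M ∣ →
    (e : Fin n) → e ∈ Matroid.E M → e ∉ X →
    ThreeConnected (delE (Matroid.E M) ⁅ e ⁆) (Matroid.r M) →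
    (conn (Matroid.E M) (Matroid.r M) X ≡ 2 ⊎ conn (Matroid.E M) (Matroid.r M) (X ∪ ⁅ e ⁆) ≡ 2) →
    (f : Fin n) → InClosure (Matroid.E M) (Matroid.r M) X f → f ∉ X → f ≢ e →
    (∀ T → Triad (Matroid.E M) (Matroid.r M) T → f ∉ T) →
    ∃[ g ] ∃[ h ] (g ∈ X × h ∈ Matroid.E M × h ∉ X ×
      Cocircuit (Matroid.E M) (Matroid.r M) (⁅ e ⁆ ∪ ⁅ f ⁆ ∪ ⁅ g ⁆ ∪ ⁅ h ⁆) ×
      ∣ ⁅ e ⁆ ∪ ⁅ f ⁆ ∪ ⁅ g ⁆ ∪ ⁅ h ⁆ ∣ ≡ 4)
lemma5p2 M M-3conn no-detachable X X⊆E 2≤∣X∣ ∣X∣+4≤∣E∣ e e∈E e∉X N-3conn λ≡2 f f∈clX f∉X f≢e no-triad =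
  QuadAcross⇒cocircuit X⊆E e∉X f∈E′ f∉X no-triad
    (QuadAcross-of-guts f∈E′ (guts-separation X⊆E e∉X f∈E′ f∉X 2≤∣X∣ ∣X∣+4≤∣E∣ λ≡2 f∈clX)
                             (deletion-not-3connected no-detachable))
  where
  open DeletionThreeConnected M M-3conn e e∈E N-3conn (≤-trans (n≤1+n 5) (≤-trans (+-monoˡ-≤ 4 2≤∣X∣) ∣X∣+4≤∣E∣))
    using (E′; deletion-not-3connected; guts-separation; QuadAcross-of-guts; QuadAcross⇒cocircuit)
  f∈E′ : f ∈ E′
  f∈E′ = x∈p∧x≢y⇒x∈p-y (proj₁ f∈clX) f≢e
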